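{- Let $\mathcal M=(E,\rho)$ be a $q$-matroid and $P(\mathcal M)=(\mathbb PE,r)$ its projectivization matroid. Then for every subspace $V\le E$, $\chi_{\mathcal M/V}(x)=\chi_{P(\mathcal M)/P(V)}(x)$.
   Context: A $q$-matroid is a pair $(E,\rho)$ where $E$ is a finite-dimensional vector space over the finite field $\mathbb F_q$ and $\rho$ assigns to each subspace a nonnegative integer with $0\le\rho(U)\le\dim U$, monotonicity and submodularity. $\mathbb PE$ is the set of $1$-dimensional subspaces; $P(V)=\{\langle v\rangle: v\in V-\{0\}\}$; $P(\mathcal M)=(\mathbb PE,r)$ with $r(S)=\rho(\langle S\rangle)$, $\langle S\rangle$ the span of the union of the lines in $S$. Contraction of a $q$-matroid: $\mathcal M/V=(E/V,\rho')$, $\rho'(W)=\rho(\pi^{ -1}(W))-\rho(V)$ with $\pi:E\to E/V$; matroid contraction $M/A=(S-A,r')$, $r'(B)=r(B\cup A)-r(A)$. Characteristic polynomials: for a $q$-matroid $(E,\rho)$, $\chi(x)=\sum_{U\le E}\mu_{\mathcal L(E)}(\{0\},U)x^{\rho(E)-\rho(U)}$ with $\mu_{\mathcal L(E)}$ the Möbius function of the subspace lattice; for a matroid $(S,r)$, $\chi(x)=\sum_{A\subseteq S}(-1)^{|A|}x^{r(S)-r(A)}$. -}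

module Defs where

open import Level using (0ℓ)
open import Algebra.Bundles using (CommutativeRing)
open import Algebra.Module.Bundles using (LeftModule)
open import Data.Bool using (Bool; true; false; _∧_; _∨_; not; if_then_else_; T)
open import Data.Nat using (ℕ; zero; suc; _∸_; _≤_; _+_; _≡ᵇ_)
open import Data.Integer as ℤ using (ℤ)
open import Data.List as L using (List; []; _∷_; length; filterᵇ; deduplicateᵇ)
open import Data.Bool.ListAction using (any; all)
open import Data.List.Relation.Unary.Any using (Any)
open import Data.List.Relation.Unary.AllPairs using (AllPairs)
open import Data.Vec as V using (Vec; lookup)
open import Data.Vec.Relation.Unary.All as VA using ()
open import Data.Fin using (Fin)
open import Data.Product using (Σ; _×_; ∃-syntax)
open import Relation.Nullary using (¬_; ⌊_⌋)
open import Relation.Binary.Definitions using (Decidable)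

record FiniteField : Set₁ where
  field
    commRing : CommutativeRing 0ℓ 0ℓ
  open CommutativeRing commRing public
  field
    0≉1 : ¬ (0# ≈ 1#)
    has-inverse : ∀ x → ¬ (x ≈ 0#) → ∃[ y ] (x * y ≈ 1#)
    _≟_ : Decidable _≈_
    elements : List Carrier
    elements-complete : ∀ x → Any (x ≈_) elements
    elements-unique : AllPairs (λ a b → ¬ (a ≈ b)) elements

record FinVectorSpace (F : FiniteField) : Set₁ where
  field
    leftModule : LeftModule (CommutativeRing.ring (FiniteField.commRing F)) 0ℓ 0ℓ
  open LeftModule leftModule public
  field
    _≟ᴹ_ : Decidable _≈ᴹ_
    vectors : List Carrierᴹ
    vectors-complete : ∀ x → Any (x ≈ᴹ_) vectors
    vectors-unique : AllPairs (λ a b → ¬ (a ≈ᴹ b)) vectors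

-- Used both for E itself and for quotients E/V (same carrier, coarser
-- equality x ~ y iff x - y ∈ V).

record SpaceData (F : FiniteField) : Set₁ where
  field
    Pt : Set
    eq : Pt → Pt → Bool
    add : Pt → Pt → Pt
    zer : Pt
    neg : Pt → Pt
    smul : FiniteField.Carrier F → Pt → Pt
    reps : List Pt

allSubsets : (k : ℕ) → List (Vec Bool k)
allSubsets zero = V.[] ∷ []
allSubsets (suc k) = L.map (true V.∷_) s L.++ L.map (false V.∷_) s
  where s = allSubsets k

_⊆ᵇ_ : ∀ {k} → Vec Bool k → Vec Bool k → Bool
U ⊆ᵇ W = V.foldr′ _∧_ true (V.zipWith (λ a b → not a ∨ b) U W)

_≡ᵛ_ : ∀ {k} → Vec Bool k → Vec Bool k → Bool
U ≡ᵛ W = (U ⊆ᵇ W) ∧ (W ⊆ᵇ U)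

_∩ᵛ_ : ∀ {k} → Vec Bool k → Vec Bool k → Vec Bool k
_∩ᵛ_ = V.zipWith _∧_

_∪ᵛ_ : ∀ {k} → Vec Bool k → Vec Bool k → Vec Bool k
_∪ᵛ_ = V.zipWith _∨_

complᵛ : ∀ {k} → Vec Bool k → Vec Bool k
complᵛ = V.map not

card : ∀ {k} → Vec Bool k → ℕ
card = V.foldr′ (λ b n → if b then suc n else n) 0

Poly : Set
Poly = ℕ → ℤ

mono : ℕ → ℤ → Poly
mono e c k = if k ≡ᵇ e then c else ℤ.0ℤ

sumP : List Poly → Poly
sumP ps k = L.foldr (λ p acc → p k ℤ.+ acc) ℤ.0ℤ ps

sign : ℕ → ℤ
sign zero = ℤ.1ℤ
sign (suc n) = ℤ.- sign n

module Lattice {F : FiniteField} (D : SpaceData F) where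
  open SpaceData D
  open FiniteField F using (elements)

  N : ℕ
  N = length reps

  -- subsets of the space (as subsets of the representatives)
  Sub : Set
  Sub = Vec Bool N

  repv : Vec Pt N
  repv = V.fromList reps

  mem : Sub → Pt → Bool
  mem U x = V.foldr′ _∨_ false (V.zipWith (λ b e → b ∧ eq x e) U repv)

  members : Sub → List Pt
  members U = filterᵇ (mem U) reps

  isSubspace : Sub → Bool
  isSubspace U =
    mem U zer
    ∧ all (λ x → all (λ y → mem U (add x y)) (members U)) (members U)
    ∧ all (λ a → all (λ x → mem U (smul a x)) (members U)) elements

  subspaces : List Sub
  subspaces = filterᵇ isSubspace (allSubsets N)

  zeroSub : Sub
  zeroSub = V.map (λ e → eq e zer) repv

  fullSub : Sub
  fullSub = V.replicate N true

  span : Sub → Sub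
  span X = L.foldr (λ U acc → if X ⊆ᵇ U then U ∩ᵛ acc else acc) fullSub subspaces

  _+ˢ_ : Sub → Sub → Sub
  U +ˢ W = span (U ∪ᵛ W)

  -- Möbius function of the lattice L (recursive definition
  -- μ(x,x) = 1, μ(x,y) = - Σ_{x ≤ z < y} μ(x,z)); the fuel (number of
  -- lattice elements + 1) bounds the length of every chain.
  μ-fuel : ℕ → Sub → Sub → ℤ
  μ-fuel zero x y = ℤ.0ℤ
  μ-fuel (suc f) x y =
    if y ≡ᵛ x then ℤ.1ℤ
    else ℤ.- L.foldr (λ z acc → μ-fuel f x z ℤ.+ acc) ℤ.0ℤ
                (filterᵇ (λ z → (x ⊆ᵇ z) ∧ (z ⊆ᵇ y) ∧ not (z ≡ᵛ y)) subspaces)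

  μ : Sub → Sub → ℤ
  μ = μ-fuel (suc (length subspaces))

  qCharPoly : (Sub → ℕ) → Poly
  qCharPoly ρ = sumP (L.map (λ U → mono (ρ fullSub ∸ ρ U) (μ zeroSub U)) subspaces)

toData : {F : FiniteField} → FinVectorSpace F → SpaceData F
toData E = record
  { Pt = Carrierᴹ ; eq = λ x y → ⌊ x ≟ᴹ y ⌋ ; add = _+ᴹ_ ; zer = 0ᴹ
  ; neg = -ᴹ_ ; smul = _*ₗ_ ; reps = vectors }
  where open FinVectorSpace E

QSub : {F : FiniteField} → FinVectorSpace F → Set
QSub E = Lattice.Sub (toData E)

isSubspaceE : {F : FiniteField} (E : FinVectorSpace F) → QSub E → Bool
isSubspaceE E = Lattice.isSubspace (toData E)

quotientData : {F : FiniteField} (E : FinVectorSpace F) → QSub E → SpaceData F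
quotientData E V = record
  { Pt = Carrierᴹ ; eq = eqV ; add = _+ᴹ_ ; zer = 0ᴹ
  ; neg = -ᴹ_ ; smul = _*ₗ_ ; reps = deduplicateᵇ eqV vectors }
  where
  open FinVectorSpace E
  eqV : Carrierᴹ → Carrierᴹ → Bool
  eqV x y = Lattice.mem (toData E) V (x +ᴹ (-ᴹ y))

module QMat {F : FiniteField} (E : FinVectorSpace F) where
  open FiniteField F using (0#) renaming (_≈_ to _≈F_; Carrier to K)
  open FinVectorSpace E
  open Lattice (toData E)

  lincomb : ∀ {k} → Vec K k → Vec Carrierᴹ k → Carrierᴹ
  lincomb c vs = V.foldr′ _+ᴹ_ 0ᴹ (V.zipWith _*ₗ_ c vs)

  LinIndep : ∀ {k} → Vec Carrierᴹ k → Set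
  LinIndep {k} vs = (c : Vec K k) → lincomb c vs ≈ᴹ 0ᴹ → (i : Fin k) → lookup c i ≈F 0#

  -- ρ(U) ≤ dim U is expressed as: U contains ρ(U) linearly independent vectors
  record IsQMatroid (ρ : Sub → ℕ) : Set where
    field
      rank-le-dim : ∀ U → T (isSubspace U) →
        Σ (Vec Carrierᴹ (ρ U)) (λ vs → VA.All (λ v → T (mem U v)) vs × LinIndep vs)
      monotone : ∀ U W → T (isSubspace U) → T (isSubspace W) → T (U ⊆ᵇ W) → ρ U ≤ ρ W
      submodular : ∀ U W → T (isSubspace U) → T (isSubspace W) →
        ρ (U +ˢ W) + ρ (U ∩ᵛ W) ≤ ρ U + ρ W

  module Q (V : Sub) = Lattice (quotientData E V)

  preimage : (V : Sub) → Q.Sub V → Sub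
  preimage V W = V.map (λ e → Q.mem V W e) repv

  contractRank : (ρ : Sub → ℕ) (V : Sub) → Q.Sub V → ℕ
  contractRank ρ V W = ρ (preimage V W) ∸ ρ V

  contractCharPoly : (ρ : Sub → ℕ) (V : Sub) → Poly
  contractCharPoly ρ V = Q.qCharPoly V (contractRank ρ V)

  nonzeroVecs : List Carrierᴹ
  nonzeroVecs = filterᵇ (λ v → not (⌊ v ≟ᴹ 0ᴹ ⌋)) vectors

  line : Carrierᴹ → Sub
  line v = V.map (λ e → any (λ a → ⌊ e ≟ᴹ (a *ₗ v) ⌋) (FiniteField.elements F)) repv

  points : List Sub
  points = deduplicateᵇ _≡ᵛ_ (L.map line nonzeroVecs)

  m : ℕ
  m = length points

  pointv : Vec Sub m
  pointv = V.fromList points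

  unionLines : Vec Bool m → Sub
  unionLines S = V.foldr′ _∪ᵛ_ (V.replicate N false)
                   (V.zipWith (λ b ℓ → if b then ℓ else V.replicate N false) S pointv)

  projSub : Sub → Vec Bool m
  projSub V = V.map (λ ℓ → any (λ v → mem V v ∧ (line v ≡ᵛ ℓ)) nonzeroVecs) pointv

record SetRank (k : ℕ) : Set where
  field
    ground : Vec Bool k
    rank : Vec Bool k → ℕ

matCharPoly : ∀ {k} → SetRank k → Poly
matCharPoly {k} M = sumP (L.map (λ A → mono (rank ground ∸ rank A) (sign (card A)))
                                 (filterᵇ (λ A → A ⊆ᵇ ground) (allSubsets k)))
  where open SetRank M

contract : ∀ {k} → SetRank k → Vec Bool k → SetRank k
contract M A = record
  { ground = ground ∩ᵛ complᵛ A
  ; rank = λ B → rank (B ∪ᵛ A) ∸ rank A }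
  where open SetRank M

projectivization : {F : FiniteField} (E : FinVectorSpace F) → (QSub E → ℕ) → SetRank (QMat.m E)
projectivization E ρ = record
  { ground = V.replicate _ true
  ; rank = λ S → ρ (Lattice.span (toData E) (QMat.unionLines E S)) }

-- Send a set A of points of ℙE − P(V) to flat A = ⟨A ∪ P(V)⟩/V, a subspace of E/V.  Since
-- ⟨A ∪ P(V)⟩ = π⁻¹(flat A), the rank of A in P(M)/P(V) is the rank of flat A in M/V, so
-- grouping the terms of χ_{P(M)/P(V)} by the fibres of flat reduces the theorem to
-- μ(0, U) = Σ_{flat A = U} (-1)^|A|.  That sum satisfies the defining recursion of μ:
-- flat A ≤ U exactly when A consists of points of π⁻¹U outside P(V), so
-- Σ_{Z ≤ U} Σ_{flat A = Z} (-1)^|A| is the alternating sum over all subsets of a finite set,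
-- which vanishes unless that set is empty, i.e. unless U = 0.

module Submission where

open import Defs
open import Level using (0ℓ)
open import Algebra.Bundles using (AbelianGroup)
import Algebra.Properties.AbelianGroup as AbelianGroupProperties
import Algebra.Properties.CommutativeSemigroup as CommutativeSemigroupProperties
open import Data.Bool as Bool using (Bool; true; false; _∧_; _∨_; not; if_then_else_; T; T?)
open import Data.Bool.ListAction using (any; all)
open import Data.Bool.Properties using (∧-zeroʳ; ∧-identityʳ)
open import Data.Empty using (⊥-elim)
open import Data.Fin using (Fin; zero; suc)
open import Data.Integer as ℤ using (ℤ; 0ℤ; 1ℤ; _+_; -_)
import Data.Integer.Properties as ℤ
open import Data.List as List using (List; []; _∷_; _++_; filterᵇ; length)
open import Data.List.Membership.Propositional using (_∈_; find; lose)
open import Data.List.Properties using (length-filter)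
open import Data.List.Membership.Propositional.Properties
  using (∈-filter⁺; ∈-filter⁻; ∈-map⁺; ∈-map⁻; ∈-++⁺ˡ; ∈-++⁺ʳ; ∈-lookup; ∈-deduplicate⁻)
open import Data.List.Relation.Unary.All as All using (All; []; _∷_)
open import Data.List.Relation.Unary.All.Properties using (all⁺; all⁻)
open import Data.List.Relation.Unary.AllPairs as AllPairs using (AllPairs; []; _∷_)
open import Data.List.Relation.Unary.Any as Any using (Any; here; there)
import Data.List.Relation.Unary.Any.Properties as Any
open import Data.List.Relation.Unary.Unique.Propositional using (Unique)
import Data.List.Relation.Unary.Unique.Propositional.Properties as Unique
open import Data.List.Relation.Unary.Unique.DecSetoid.Properties using (deduplicate-!)
open import Data.Nat as ℕ using (ℕ; zero; suc; _≤_; _<_; z≤n; s≤s; _∸_)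
import Data.Nat.Properties as ℕ
open import Data.Product using (Σ; _×_; _,_; proj₁; proj₂; ∃-syntax)
open import Data.Sum using (_⊎_; inj₁; inj₂)
open import Data.Vec as Vec using (Vec; lookup)
import Data.Vec.Properties as Vec
open import Function using (_∘_)
open import Relation.Nullary using (¬_; ⌊_⌋; yes; no)
open import Relation.Nullary.Decidable using (toWitness; fromWitness)
open import Relation.Binary.Bundles using (DecSetoid)
open import Relation.Binary.Definitions using (DecidableEquality)
open import Relation.Binary.PropositionalEquality
import Relation.Binary.Reasoning.Setoid as SetoidReasoning

T-∧⁺ : ∀ {a b} → T a → T b → T (a ∧ b)
T-∧⁺ {true} _ tb = tb

T-∧⁻ˡ : ∀ {a b} → T (a ∧ b) → T a
T-∧⁻ˡ {true} _ = _

T-∧⁻ʳ : ∀ {a b} → T (a ∧ b) → T b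
T-∧⁻ʳ {true} tb = tb

T-∨⁻ : ∀ {a b} → T (a ∨ b) → T a ⊎ T b
T-∨⁻ {true} _ = inj₁ _
T-∨⁻ {false} tb = inj₂ tb

T-∨⁺ˡ : ∀ {a b} → T a → T (a ∨ b)
T-∨⁺ˡ {true} _ = _

T-∨⁺ʳ : ∀ {a b} → T b → T (a ∨ b)
T-∨⁺ʳ {true} _ = _
T-∨⁺ʳ {false} tb = tb

T-not⁺ : ∀ {a} → ¬ T a → T (not a)
T-not⁺ {true} f = f _
T-not⁺ {false} _ = _

T-not⁻ : ∀ {a} → T (not a) → ¬ T a
T-not⁻ {true} ()

T⇒≡true : ∀ {a} → T a → a ≡ true
T⇒≡true {true} _ = refl

¬T⇒≡false : ∀ {a} → ¬ T a → a ≡ false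
¬T⇒≡false {true} f = ⊥-elim (f _)
¬T⇒≡false {false} _ = refl

T-ext : ∀ {a b} → (T a → T b) → (T b → T a) → a ≡ b
T-ext {true} {true} _ _ = refl
T-ext {true} {false} f _ = ⊥-elim (f _)
T-ext {false} {true} _ g = ⊥-elim (g _)
T-ext {false} {false} _ _ = refl

module _ {k : ℕ} where

  _⊆_ : Vec Bool k → Vec Bool k → Set
  U ⊆ W = ∀ i → T (lookup U i) → T (lookup W i)

  ⊆-refl : ∀ {U} → U ⊆ U
  ⊆-refl _ t = t

  ⊆-trans : ∀ {U W X} → U ⊆ W → W ⊆ X → U ⊆ X
  ⊆-trans f g i t = g i (f i t)

  ⊆-antisym : ∀ {U W} → U ⊆ W → W ⊆ U → U ≡ W
  ⊆-antisym {U} {W} f g = begin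
    U                          ≡⟨ Vec.tabulate∘lookup U ⟨
    Vec.tabulate (lookup U)    ≡⟨ Vec.tabulate-cong (λ i → T-ext (f i) (g i)) ⟩
    Vec.tabulate (lookup W)    ≡⟨ Vec.tabulate∘lookup W ⟩
    W                          ∎
    where open ≡-Reasoning

⊆ᵇ-sound : ∀ {k} (U W : Vec Bool k) → T (U ⊆ᵇ W) → U ⊆ W
⊆ᵇ-sound (true Vec.∷ U) (true Vec.∷ W) t zero _ = _
⊆ᵇ-sound (u Vec.∷ U) (w Vec.∷ W) t (suc i) = ⊆ᵇ-sound U W (T-∧⁻ʳ {not u ∨ w} t) i

⊆ᵇ-complete : ∀ {k} (U W : Vec Bool k) → U ⊆ W → T (U ⊆ᵇ W)
⊆ᵇ-complete Vec.[] Vec.[] _ = _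
⊆ᵇ-complete (u Vec.∷ U) (w Vec.∷ W) f =
  T-∧⁺ (head u w (f zero)) (⊆ᵇ-complete U W (f ∘ suc))
  where
  head : ∀ u w → (T u → T w) → T (not u ∨ w)
  head true true _ = _
  head true false g = g _
  head false _ _ = _

≡ᵛ-sound : ∀ {k} (U W : Vec Bool k) → T (U ≡ᵛ W) → U ≡ W
≡ᵛ-sound U W t = ⊆-antisym (⊆ᵇ-sound U W (T-∧⁻ˡ t)) (⊆ᵇ-sound W U (T-∧⁻ʳ {U ⊆ᵇ W} t))

≡ᵛ-refl : ∀ {k} (U : Vec Bool k) → T (U ≡ᵛ U)
≡ᵛ-refl U = T-∧⁺ (⊆ᵇ-complete U U (⊆-refl {U = U})) (⊆ᵇ-complete U U (⊆-refl {U = U}))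

≡⇒≡ᵛ : ∀ {k} {U W : Vec Bool k} → U ≡ W → T (U ≡ᵛ W)
≡⇒≡ᵛ {U = U} refl = ≡ᵛ-refl U

T-lookup-replicate : ∀ {k} (i : Fin k) → T (lookup (Vec.replicate k true) i)
T-lookup-replicate i = subst T (sym (Vec.lookup-replicate i true)) _

⊈-witness : ∀ {k} (U W : Vec Bool k) → ¬ U ⊆ W → ∃[ i ] (T (lookup U i) × ¬ T (lookup W i))
⊈-witness Vec.[] Vec.[] U⊈W = ⊥-elim (U⊈W (λ ()))
⊈-witness (true Vec.∷ U) (false Vec.∷ W) _ = zero , _ , λ ()
⊈-witness (false Vec.∷ U) (w Vec.∷ W) U⊈W = let i , p = ⊈-witness U W (U⊈W ∘ extend λ ()) in suc i , p
  where
  extend : (T false → T w) → U ⊆ W → (false Vec.∷ U) ⊆ (w Vec.∷ W)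
  extend h U⊆W zero = h
  extend h U⊆W (suc i) = U⊆W i
⊈-witness (u Vec.∷ U) (true Vec.∷ W) U⊈W = let i , p = ⊈-witness U W (U⊈W ∘ extend) in suc i , p
  where
  extend : U ⊆ W → (u Vec.∷ U) ⊆ (true Vec.∷ W)
  extend U⊆W zero _ = _
  extend U⊆W (suc i) = U⊆W i

anyᵛ : ∀ {k} → Vec Bool k → Bool
anyᵛ = Vec.foldr′ _∨_ false

anyᵛ-sound : ∀ {k} (v : Vec Bool k) → T (anyᵛ v) → ∃[ i ] T (lookup v i)
anyᵛ-sound (x Vec.∷ v) t with T-∨⁻ {x} t
... | inj₁ tx = zero , tx
... | inj₂ tv = let i , ti = anyᵛ-sound v tv in suc i , ti

anyᵛ-complete : ∀ {k} (v : Vec Bool k) i → T (lookup v i) → T (anyᵛ v)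
anyᵛ-complete (x Vec.∷ v) zero t = T-∨⁺ˡ t
anyᵛ-complete (x Vec.∷ v) (suc i) t = T-∨⁺ʳ {x} (anyᵛ-complete v i t)

anyᵛ-lookup-⋃ : ∀ {k n} (vs : Vec (Vec Bool k) n) j →
  lookup (Vec.foldr′ _∪ᵛ_ (Vec.replicate k false) vs) j ≡ anyᵛ (Vec.map (λ v → lookup v j) vs)
anyᵛ-lookup-⋃ Vec.[] j = Vec.lookup-replicate j false
anyᵛ-lookup-⋃ (v Vec.∷ vs) j =
  trans (Vec.lookup-zipWith _∨_ j v _) (cong (lookup v j ∨_) (anyᵛ-lookup-⋃ vs j))

allSubsets-complete : ∀ k (U : Vec Bool k) → U ∈ allSubsets k
allSubsets-complete zero Vec.[] = here refl
allSubsets-complete (suc k) (true Vec.∷ U) = ∈-++⁺ˡ (∈-map⁺ (true Vec.∷_) (allSubsets-complete k U))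
allSubsets-complete (suc k) (false Vec.∷ U) =
  ∈-++⁺ʳ (List.map (true Vec.∷_) (allSubsets k)) (∈-map⁺ (false Vec.∷_) (allSubsets-complete k U))

allSubsets-unique : ∀ k → Unique (allSubsets k)
allSubsets-unique zero = [] ∷ []
allSubsets-unique (suc k) = Unique.++⁺ (cons-unique true) (cons-unique false) disjoint
  where
  cons-unique : ∀ b → Unique (List.map (b Vec.∷_) (allSubsets k))
  cons-unique b = Unique.map⁺ Vec.∷-injectiveʳ (allSubsets-unique k)
  disjoint : ∀ {v} → ¬ (v ∈ List.map (true Vec.∷_) (allSubsets k) × v ∈ List.map (false Vec.∷_) (allSubsets k))
  disjoint (p , q) with ∈-map⁻ (true Vec.∷_) p | ∈-map⁻ (false Vec.∷_) q
  ... | _ , _ , refl | _ , _ , ()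

lookup-fromList : ∀ {A : Set} (xs : List A) i → lookup (Vec.fromList xs) i ≡ List.lookup xs i
lookup-fromList (x ∷ xs) zero = refl
lookup-fromList (x ∷ xs) (suc i) = lookup-fromList xs i

lookup-fromList-∈ : ∀ {A : Set} (xs : List A) i → lookup (Vec.fromList xs) i ∈ xs
lookup-fromList-∈ xs i = subst (_∈ xs) (sym (lookup-fromList xs i)) (∈-lookup i)

lookup-fromList-index : ∀ {A : Set} {P : A → Set} {xs} (p : Any P xs) →
                        P (lookup (Vec.fromList xs) (Any.index p))
lookup-fromList-index {P = P} {xs} p = subst P (sym (lookup-fromList xs (Any.index p))) (Any.lookup-index p)

sumℤ : ∀ {A : Set} → (A → ℤ) → List A → ℤ
sumℤ f = List.foldr (λ a acc → f a + acc) 0ℤ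

when : Bool → ℤ → ℤ
when b z = if b then z else 0ℤ

when-neg : ∀ b z → when b (- z) ≡ - when b z
when-neg true z = refl
when-neg false z = refl

when-∧ : ∀ a b z → when a (when b z) ≡ when (a ∧ b) z
when-∧ true b z = refl
when-∧ false b z = refl

module _ {A : Set} where

  sumℤ-cong : ∀ {f g : A → ℤ} xs → (∀ {x} → x ∈ xs → f x ≡ g x) → sumℤ f xs ≡ sumℤ g xs
  sumℤ-cong [] _ = refl
  sumℤ-cong (x ∷ xs) f≡g = cong₂ _+_ (f≡g (here refl)) (sumℤ-cong xs (f≡g ∘ there))

  sumℤ-zero : ∀ (f : A → ℤ) xs → (∀ {x} → x ∈ xs → f x ≡ 0ℤ) → sumℤ f xs ≡ 0ℤ
  sumℤ-zero f [] _ = refl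
  sumℤ-zero f (x ∷ xs) f≡0 = cong₂ _+_ (f≡0 (here refl)) (sumℤ-zero f xs (f≡0 ∘ there))

  sumℤ-filter : ∀ (f : A → ℤ) (p : A → Bool) xs →
                sumℤ f (filterᵇ p xs) ≡ sumℤ (λ x → when (p x) (f x)) xs
  sumℤ-filter f p [] = refl
  sumℤ-filter f p (x ∷ xs) with p x
  ... | true = cong (f x +_) (sumℤ-filter f p xs)
  ... | false = trans (sumℤ-filter f p xs) (sym (ℤ.+-identityˡ _))

  sumℤ-+ : ∀ (f g : A → ℤ) xs → sumℤ (λ x → f x + g x) xs ≡ sumℤ f xs + sumℤ g xs
  sumℤ-+ f g [] = refl
  sumℤ-+ f g (x ∷ xs) =
    trans (cong (f x + g x +_) (sumℤ-+ f g xs)) (+-interchange (f x) (g x) (sumℤ f xs) (sumℤ g xs))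
    where open CommutativeSemigroupProperties ℤ.+-commutativeSemigroup renaming (interchange to +-interchange)

  sumℤ-neg : ∀ (f : A → ℤ) xs → sumℤ (λ x → - f x) xs ≡ - sumℤ f xs
  sumℤ-neg f [] = refl
  sumℤ-neg f (x ∷ xs) = trans (cong (- f x +_) (sumℤ-neg f xs)) (sym (ℤ.neg-distrib-+ (f x) (sumℤ f xs)))

  sumℤ-++ : ∀ (f : A → ℤ) xs ys → sumℤ f (xs ++ ys) ≡ sumℤ f xs + sumℤ f ys
  sumℤ-++ f [] ys = sym (ℤ.+-identityˡ _)
  sumℤ-++ f (x ∷ xs) ys = trans (cong (f x +_) (sumℤ-++ f xs ys)) (sym (ℤ.+-assoc (f x) (sumℤ f xs) (sumℤ f ys)))

  sumℤ-map : ∀ {B : Set} (f : B → ℤ) (g : A → B) xs → sumℤ f (List.map g xs) ≡ sumℤ (f ∘ g) xs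
  sumℤ-map f g [] = refl
  sumℤ-map f g (x ∷ xs) = cong (f (g x) +_) (sumℤ-map f g xs)

  when-sumℤ : ∀ b (f : A → ℤ) xs → when b (sumℤ f xs) ≡ sumℤ (λ x → when b (f x)) xs
  when-sumℤ true f xs = refl
  when-sumℤ false f xs = sym (sumℤ-zero _ xs (λ _ → refl))

  sumP-map : ∀ (f : A → Poly) xs k → sumP (List.map f xs) k ≡ sumℤ (λ x → f x k) xs
  sumP-map f [] k = refl
  sumP-map f (x ∷ xs) k = cong (f x k +_) (sumP-map f xs k)

  mono-sumℤ : ∀ e (f : A → ℤ) xs k → mono e (sumℤ f xs) k ≡ sumℤ (λ x → mono e (f x) k) xs
  mono-sumℤ e f xs k with k ℕ.≡ᵇ e
  ... | true = refl
  ... | false = sym (sumℤ-zero _ xs (λ _ → refl))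

module _ {B : Set} (_≟_ : DecidableEquality B) where

  sumℤ-indicator : (w : B → ℤ) {c : B} {ys : List B} → Unique ys → c ∈ ys →
                   sumℤ (λ b → when ⌊ c ≟ b ⌋ (w b)) ys ≡ w c
  sumℤ-indicator w {c} {_ ∷ ys} (c∉ys ∷ _) (here refl) with c ≟ c
  ... | no c≢c = ⊥-elim (c≢c refl)
  ... | yes _ = trans (cong (w c +_) (sumℤ-zero _ ys off)) (ℤ.+-identityʳ (w c))
    where
    off : ∀ {x} → x ∈ ys → when ⌊ c ≟ x ⌋ (w x) ≡ 0ℤ
    off {x} x∈ys with c ≟ x
    ... | no _ = refl
    ... | yes refl = ⊥-elim (All.lookup c∉ys x∈ys refl)
  sumℤ-indicator w {c} {y ∷ _} (y∉ys ∷ u) (there c∈ys) with c ≟ y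
  ... | no _ = trans (ℤ.+-identityˡ _) (sumℤ-indicator w u c∈ys)
  ... | yes refl = ⊥-elim (All.lookup y∉ys c∈ys refl)

  fibre : ∀ {A : Set} → (A → B) → List A → B → List A
  fibre h xs b = filterᵇ (λ a → ⌊ h a ≟ b ⌋) xs

  fibre-∈⁻ : ∀ {A : Set} (h : A → B) xs {a b} → a ∈ fibre h xs b → a ∈ xs × h a ≡ b
  fibre-∈⁻ h xs a∈ = let a∈xs , t = ∈-filter⁻ (T? ∘ (λ a → ⌊ h a ≟ _ ⌋)) a∈ in a∈xs , toWitness t

  sumℤ-fibres : ∀ {A : Set} (f : A → ℤ) (h : A → B) xs {ys} → Unique ys → (∀ {a} → a ∈ xs → h a ∈ ys) →
                sumℤ f xs ≡ sumℤ (λ b → sumℤ f (fibre h xs b)) ys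
  sumℤ-fibres f h [] {ys} _ _ = sym (sumℤ-zero _ ys (λ _ → refl))
  sumℤ-fibres f h (x ∷ xs) {ys} u h∈ = begin
    f x + sumℤ f xs
      ≡⟨ cong₂ _+_ (sumℤ-indicator (λ _ → f x) u (h∈ (here refl)))
                     (sym (sumℤ-fibres f h xs u (h∈ ∘ there))) ⟨
    sumℤ (λ b → when ⌊ h x ≟ b ⌋ (f x)) ys + sumℤ (λ b → sumℤ f (fibre h xs b)) ys
      ≡⟨ sumℤ-+ (λ b → when ⌊ h x ≟ b ⌋ (f x)) (λ b → sumℤ f (fibre h xs b)) ys ⟨
    sumℤ (λ b → when ⌊ h x ≟ b ⌋ (f x) + sumℤ f (fibre h xs b)) ys
      ≡⟨ sumℤ-cong ys (λ {b} _ → cons b) ⟩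
    sumℤ (λ b → sumℤ f (fibre h (x ∷ xs) b)) ys ∎
    where
    open ≡-Reasoning
    cons : ∀ b → when ⌊ h x ≟ b ⌋ (f x) + sumℤ f (fibre h xs b) ≡ sumℤ f (fibre h (x ∷ xs) b)
    cons b with h x ≟ b
    ... | yes _ = refl
    ... | no _ = ℤ.+-identityˡ _

alternating-sum-subsets : ∀ k (G : Vec Bool k) →
  sumℤ (λ A → when (A ⊆ᵇ G) (sign (card A))) (allSubsets k) ≡ when (not (anyᵛ G)) 1ℤ
alternating-sum-subsets zero Vec.[] = refl
alternating-sum-subsets (suc k) (g Vec.∷ G) = begin
  sumℤ f (List.map (true Vec.∷_) 𝒮 ++ List.map (false Vec.∷_) 𝒮)
    ≡⟨ sumℤ-++ f (List.map (true Vec.∷_) 𝒮) _ ⟩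
  sumℤ f (List.map (true Vec.∷_) 𝒮) + sumℤ f (List.map (false Vec.∷_) 𝒮)
    ≡⟨ cong₂ _+_ (sumℤ-map f (true Vec.∷_) 𝒮) (sumℤ-map f (false Vec.∷_) 𝒮) ⟩
  sumℤ (λ A → when (g ∧ (A ⊆ᵇ G)) (- sign (card A))) 𝒮 + Σ𝒮
    ≡⟨ cong (_+ Σ𝒮) (with-g g) ⟩
  when g (- Σ𝒮) + Σ𝒮
    ≡⟨ cong (λ z → when g (- z) + z) (alternating-sum-subsets k G) ⟩
  when g (- when (not (anyᵛ G)) 1ℤ) + when (not (anyᵛ G)) 1ℤ
    ≡⟨ cancel g ⟩
  when (not (g ∨ anyᵛ G)) 1ℤ ∎
  where
  open ≡-Reasoning
  𝒮 = allSubsets k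
  f : Vec Bool (suc k) → ℤ
  f A = when (A ⊆ᵇ (g Vec.∷ G)) (sign (card A))
  Σ𝒮 = sumℤ (λ A → when (A ⊆ᵇ G) (sign (card A))) 𝒮
  with-g : ∀ g → sumℤ (λ A → when (g ∧ (A ⊆ᵇ G)) (- sign (card A))) 𝒮 ≡ when g (- Σ𝒮)
  with-g true = trans (sumℤ-cong 𝒮 (λ {A} _ → when-neg (A ⊆ᵇ G) (sign (card A))))
                      (sumℤ-neg (λ A → when (A ⊆ᵇ G) (sign (card A))) 𝒮)
  with-g false = sumℤ-zero _ 𝒮 (λ _ → refl)
  cancel : ∀ g → when g (- when (not (anyᵛ G)) 1ℤ) + when (not (anyᵛ G)) 1ℤ
                 ≡ when (not (g ∨ anyᵛ G)) 1ℤ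
  cancel true = ℤ.+-inverseˡ (when (not (anyᵛ G)) 1ℤ)
  cancel false = ℤ.+-identityˡ _

length-filter-≤ : ∀ {A : Set} (p q : A → Bool) xs → (∀ y → T (p y) → T (q y)) →
                  length (filterᵇ p xs) ≤ length (filterᵇ q xs)
length-filter-≤ p q [] p⇒q = z≤n
length-filter-≤ p q (y ∷ xs) p⇒q with p y in py | q y in qy
... | true | true = s≤s (length-filter-≤ p q xs p⇒q)
... | true | false = ⊥-elim (subst T qy (p⇒q y (subst T (sym py) _)))
... | false | true = ℕ.m≤n⇒m≤1+n (length-filter-≤ p q xs p⇒q)
... | false | false = length-filter-≤ p q xs p⇒q

length-filter-< : ∀ {A : Set} (p q : A → Bool) xs → (∀ y → T (p y) → T (q y)) →
                  ∀ {w} → w ∈ xs → T (q w) → ¬ T (p w) → length (filterᵇ p xs) < length (filterᵇ q xs)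
length-filter-< p q (y ∷ xs) p⇒q (here refl) qw ¬pw with p y | q y
... | true | _ = ⊥-elim (¬pw _)
... | false | true = s≤s (length-filter-≤ p q xs p⇒q)
length-filter-< p q (y ∷ xs) p⇒q (there w∈xs) qw ¬pw with p y in py | q y in qy
... | true | true = s≤s (length-filter-< p q xs p⇒q w∈xs qw ¬pw)
... | true | false = ⊥-elim (subst T qy (p⇒q y (subst T (sym py) _)))
... | false | true = ℕ.m≤n⇒m≤1+n (length-filter-< p q xs p⇒q w∈xs qw ¬pw)
... | false | false = length-filter-< p q xs p⇒q w∈xs qw ¬pw

module MöbiusRecursion {F : FiniteField} (D : SpaceData F) where
  open Lattice D

  strictlyBelow : Sub → Sub → Bool
  strictlyBelow U Z = (zeroSub ⊆ᵇ Z) ∧ (Z ⊆ᵇ U) ∧ not (Z ≡ᵛ U)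

  properlyContained : Sub → Sub → Bool
  properlyContained U Z = (Z ⊆ᵇ U) ∧ not (Z ≡ᵛ U)

  -- the number of subspaces properly contained in U bounds the fuel μ needs at U
  height : Sub → ℕ
  height U = length (filterᵇ (properlyContained U) subspaces)

  height-< : ∀ {U Z} → Z ∈ subspaces → T (strictlyBelow U Z) → height Z < height U
  height-< {U} {Z} Z∈ Z<U =
    length-filter-< _ _ subspaces below-Z⇒below-U Z∈
      (T-∧⁺ (⊆ᵇ-complete Z U Z⊆U) (T-not⁺ (Z≢U ∘ ≡ᵛ-sound Z U)))
      (λ t → T-not⁻ (T-∧⁻ʳ {Z ⊆ᵇ Z} t) (≡ᵛ-refl Z))
    where
    Z⊆U = ⊆ᵇ-sound Z U (T-∧⁻ˡ (T-∧⁻ʳ {zeroSub ⊆ᵇ Z} Z<U))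
    Z≢U : ¬ Z ≡ U
    Z≢U Z≡U = T-not⁻ (T-∧⁻ʳ {Z ⊆ᵇ U} (T-∧⁻ʳ {zeroSub ⊆ᵇ Z} Z<U)) (≡⇒≡ᵛ Z≡U)
    below-Z⇒below-U : ∀ Y → T (properlyContained Z Y) → T (properlyContained U Y)
    below-Z⇒below-U Y t = T-∧⁺ (⊆ᵇ-complete Y U (⊆-trans {U = Y} {Z} {U} Y⊆Z Z⊆U))
      (T-not⁺ λ Y≡U → Z≢U (⊆-antisym {U = Z} Z⊆U (subst (_⊆ Z) (≡ᵛ-sound Y U Y≡U) Y⊆Z)))
      where Y⊆Z = ⊆ᵇ-sound Y Z (T-∧⁻ˡ t)

  module _ (g : Sub → ℤ)
           (recursion : ∀ U → U ∈ subspaces →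
              g U + sumℤ g (filterᵇ (strictlyBelow U) subspaces) ≡ when (U ≡ᵛ zeroSub) 1ℤ) where

    private
      open AbelianGroupProperties ℤ.+-0-abelianGroup using (inverseˡ-unique)

      nothing-below-0 : ∀ U → U ≡ zeroSub → sumℤ g (filterᵇ (strictlyBelow U) subspaces) ≡ 0ℤ
      nothing-below-0 U refl = trans (sumℤ-filter g (strictlyBelow U) subspaces)
                                     (sumℤ-zero _ subspaces (λ {Z} _ → off Z))
        where
        off : ∀ Z → when (strictlyBelow U Z) (g Z) ≡ 0ℤ
        off Z with strictlyBelow U Z in Z<U
        ... | false = refl
        ... | true = ⊥-elim (T-not⁻ (T-∧⁻ʳ {Z ⊆ᵇ U} t₂) (≡⇒≡ᵛ Z≡U))
          where
          t = subst T (sym Z<U) _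
          t₂ = T-∧⁻ʳ {zeroSub ⊆ᵇ Z} t
          Z≡U = ⊆-antisym {U = Z} (⊆ᵇ-sound Z U (T-∧⁻ˡ t₂)) (⊆ᵇ-sound zeroSub Z (T-∧⁻ˡ t))

      μ-fuel-solves : ∀ f U → U ∈ subspaces → height U < f → μ-fuel f zeroSub U ≡ g U
      μ-fuel-solves (suc f) U U∈ (s≤s h<f) with U ≡ᵛ zeroSub in U≟0
      ... | true = sym (begin
        g U                                            ≡⟨ ℤ.+-identityʳ (g U) ⟨
        g U + 0ℤ                                       ≡⟨ cong (g U +_) (nothing-below-0 U U≡0) ⟨
        g U + sumℤ g (filterᵇ (strictlyBelow U) subspaces) ≡⟨ recursion U U∈ ⟩
        when (U ≡ᵛ zeroSub) 1ℤ                         ≡⟨ cong (λ b → when b 1ℤ) U≟0 ⟩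
        1ℤ                                             ∎)
        where
        open ≡-Reasoning
        U≡0 = ≡ᵛ-sound U zeroSub (subst T (sym U≟0) _)
      ... | false = begin
        - sumℤ (μ-fuel f zeroSub) (filterᵇ (strictlyBelow U) subspaces)
          ≡⟨ cong -_ (sumℤ-cong _ λ {Z} Z∈ →
               let Z∈′ , Z<U = ∈-filter⁻ (T? ∘ strictlyBelow U) Z∈ in
               μ-fuel-solves f Z Z∈′ (ℕ.<-≤-trans (height-< Z∈′ Z<U) h<f)) ⟩
        - sumℤ g (filterᵇ (strictlyBelow U) subspaces)
          ≡⟨ inverseˡ-unique (g U) _ (trans (recursion U U∈) (cong (λ b → when b 1ℤ) U≟0)) ⟨
        g U ∎
        where open ≡-Reasoning

    μ-unique : ∀ U → U ∈ subspaces → μ zeroSub U ≡ g U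
    μ-unique U U∈ = μ-fuel-solves (suc (length subspaces)) U U∈
                      (s≤s (length-filter (T? ∘ properlyContained U) subspaces))

record IsWellFormed {F : FiniteField} (D : SpaceData F) : Set where
  open SpaceData D
  open FiniteField F using (_≈_)
  field
    eq-refl : ∀ x → T (eq x x)
    eq-sym : ∀ {x y} → T (eq x y) → T (eq y x)
    eq-trans : ∀ {x y z} → T (eq x y) → T (eq y z) → T (eq x z)
    reps-unique : AllPairs (λ a b → ¬ T (eq a b)) reps
    reps-complete : ∀ x → Any (λ r → T (eq x r)) reps
    add-cong : ∀ {x x′ y y′} → T (eq x x′) → T (eq y y′) → T (eq (add x y) (add x′ y′))
    smul-cong : ∀ {a b x y} → a ≈ b → T (eq x y) → T (eq (smul a x) (smul b y))

module WellFormed {F : FiniteField} {D : SpaceData F} (wf : IsWellFormed D) where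
  open SpaceData D
  open IsWellFormed wf public
  open Lattice D public
  open FiniteField F using (elements; elements-complete)

  ι : Pt → Fin N
  ι x = Any.index (reps-complete x)

  rep : Fin N → Pt
  rep i = lookup repv i

  private
    memIn : (xs : List Pt) → Vec Bool (length xs) → Pt → Bool
    memIn xs U x = Vec.foldr′ _∨_ false (Vec.zipWith (λ b e → b ∧ eq x e) U (Vec.fromList xs))

    ¬eq-transˡ : ∀ {x r} xs → T (eq x r) → All (λ s → ¬ T (eq r s)) xs → All (λ s → ¬ T (eq x s)) xs
    ¬eq-transˡ [] _ [] = []
    ¬eq-transˡ (s ∷ xs) x~r (r≁s ∷ r≁xs) = (r≁s ∘ eq-trans (eq-sym x~r)) ∷ ¬eq-transˡ xs x~r r≁xs

    ¬eq-any : ∀ {x r} xs → Any (λ s → T (eq x s)) xs → All (λ s → ¬ T (eq r s)) xs → ¬ T (eq x r)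
    ¬eq-any (s ∷ xs) (here x~s) (r≁s ∷ _) x~r = r≁s (eq-trans (eq-sym x~r) x~s)
    ¬eq-any (s ∷ xs) (there x~xs) (_ ∷ r≁xs) = ¬eq-any xs x~xs r≁xs

    memIn-none : ∀ xs U x → All (λ r → ¬ T (eq x r)) xs → memIn xs U x ≡ false
    memIn-none [] Vec.[] x [] = refl
    memIn-none (r ∷ xs) (b Vec.∷ U) x (x≁r ∷ x≁xs)
      rewrite ¬T⇒≡false x≁r | memIn-none xs U x x≁xs with b
    ... | true = refl
    ... | false = refl

    memIn-index : ∀ xs → AllPairs (λ a b → ¬ T (eq a b)) xs → ∀ x (p : Any (λ r → T (eq x r)) xs) U →
                  memIn xs U x ≡ lookup U (Any.index p)
    memIn-index (r ∷ xs) (r≁xs ∷ _) x (here x~r) (b Vec.∷ U)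
      rewrite T⇒≡true x~r | memIn-none xs U x (¬eq-transˡ xs x~r r≁xs) with b
    ... | true = refl
    ... | false = refl
    memIn-index (r ∷ xs) (r≁xs ∷ u) x (there p) (b Vec.∷ U)
      rewrite ¬T⇒≡false (¬eq-any xs p r≁xs) with b
    ... | true = memIn-index xs u x p U
    ... | false = memIn-index xs u x p U

    index-unique : ∀ xs → AllPairs (λ a b → ¬ T (eq a b)) xs → ∀ {x y} → T (eq x y) →
                   (p : Any (λ r → T (eq x r)) xs) (q : Any (λ r → T (eq y r)) xs) →
                   Any.index p ≡ Any.index q
    index-unique (r ∷ xs) _ x~y (here _) (here _) = refl
    index-unique (r ∷ xs) (r≁xs ∷ _) x~y (here x~r) (there q) =
      ⊥-elim (¬eq-any xs q r≁xs (eq-trans (eq-sym x~y) x~r))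
    index-unique (r ∷ xs) (r≁xs ∷ _) x~y (there p) (here y~r) =
      ⊥-elim (¬eq-any xs p r≁xs (eq-trans x~y y~r))
    index-unique (r ∷ xs) (_ ∷ u) x~y (there p) (there q) = cong suc (index-unique xs u x~y p q)

  mem-ι : ∀ U x → mem U x ≡ lookup U (ι x)
  mem-ι U x = memIn-index reps reps-unique x (reps-complete x) U

  ι-cong : ∀ {x y} → T (eq x y) → ι x ≡ ι y
  ι-cong x~y = index-unique reps reps-unique x~y (reps-complete _) (reps-complete _)

  rep-ι : ∀ x → T (eq x (rep (ι x)))
  rep-ι x = lookup-fromList-index (reps-complete x)

  ι-rep : ∀ i → ι (rep i) ≡ i
  ι-rep i = trans (index-unique reps reps-unique (eq-refl _) (reps-complete (rep i)) (proj₁ (self reps i)))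
                  (proj₂ (self reps i))
    where
    self : ∀ (xs : List Pt) j →
           Σ (Any (λ r → T (eq (lookup (Vec.fromList xs) j) r)) xs) (λ p → Any.index p ≡ j)
    self (x ∷ xs) zero = here (eq-refl x) , refl
    self (x ∷ xs) (suc j) = there (proj₁ (self xs j)) , cong suc (proj₂ (self xs j))

  mem-cong : ∀ U {x y} → T (eq x y) → mem U x ≡ mem U y
  mem-cong U {x} {y} x~y = trans (mem-ι U x) (trans (cong (lookup U) (ι-cong x~y)) (sym (mem-ι U y)))

  mem-rep : ∀ U i → mem U (rep i) ≡ lookup U i
  mem-rep U i = trans (mem-ι U (rep i)) (cong (lookup U) (ι-rep i))

  _∋_ : Sub → Pt → Set
  U ∋ x = T (mem U x)

  ∋-resp : ∀ U {x y} → T (eq x y) → U ∋ x → U ∋ y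
  ∋-resp U x~y = subst T (mem-cong U x~y)

  ⊆⇒∋ : ∀ U W → U ⊆ W → ∀ x → U ∋ x → W ∋ x
  ⊆⇒∋ U W U⊆W x t = subst T (sym (mem-ι W x)) (U⊆W (ι x) (subst T (mem-ι U x) t))

  ∋⇒⊆ : ∀ U W → (∀ x → U ∋ x → W ∋ x) → U ⊆ W
  ∋⇒⊆ U W f i t = subst T (mem-rep W i) (f (rep i) (subst T (sym (mem-rep U i)) t))

  ∋-ext : ∀ U W → (∀ x → U ∋ x → W ∋ x) → (∀ x → W ∋ x → U ∋ x) → U ≡ W
  ∋-ext U W f g = ⊆-antisym (∋⇒⊆ U W f) (∋⇒⊆ W U g)

  mem-tabulate : ∀ (f : Pt → Bool) → (∀ {x y} → T (eq x y) → f x ≡ f y) →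
                 ∀ x → mem (Vec.map f repv) x ≡ f x
  mem-tabulate f f-cong x = trans (mem-ι (Vec.map f repv) x)
                                  (trans (Vec.lookup-map (ι x) f repv) (sym (f-cong (rep-ι x))))

  mem-zeroSub : ∀ x → mem zeroSub x ≡ eq x zer
  mem-zeroSub = mem-tabulate (λ e → eq e zer)
    (λ x~y → T-ext (eq-trans (eq-sym x~y)) (eq-trans x~y))

  fullSub-∋ : ∀ x → fullSub ∋ x
  fullSub-∋ x = subst T (sym (mem-ι fullSub x)) (T-lookup-replicate (ι x))

  mem-∩ : ∀ U W x → mem (U ∩ᵛ W) x ≡ mem U x ∧ mem W x
  mem-∩ U W x = trans (mem-ι (U ∩ᵛ W) x)
    (trans (Vec.lookup-zipWith _∧_ (ι x) U W) (sym (cong₂ _∧_ (mem-ι U x) (mem-ι W x))))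

  record IsSubspace (U : Sub) : Set where
    field
      ∋zer : U ∋ zer
      ∋add : ∀ {x y} → U ∋ x → U ∋ y → U ∋ add x y
      ∋smul : ∀ a {x} → U ∋ x → U ∋ smul a x

  private
    members-∋ : ∀ U {x} → x ∈ members U → U ∋ x
    members-∋ U x∈ = proj₂ (∈-filter⁻ (T? ∘ mem U) {xs = reps} x∈)

    rep-∈-members : ∀ U x → U ∋ x → rep (ι x) ∈ members U
    rep-∈-members U x t = ∈-filter⁺ (T? ∘ mem U)
      (lookup-fromList-∈ reps (ι x))
      (subst T (trans (mem-ι U x) (sym (mem-rep U (ι x)))) t)

    all-sound : ∀ {A : Set} (p : A → Bool) {xs} → T (all p xs) → ∀ {x} → x ∈ xs → T (p x)
    all-sound p {xs} t = All.lookup (all⁺ p xs t)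

    all-complete : ∀ {A : Set} (p : A → Bool) xs → (∀ {x} → x ∈ xs → T (p x)) → T (all p xs)
    all-complete p xs h = all⁻ p (All.tabulate h)

  isSubspace-sound : ∀ U → T (isSubspace U) → IsSubspace U
  isSubspace-sound U t = record { ∋zer = T-∧⁻ˡ t ; ∋add = ∋add ; ∋smul = ∋smul }
    where
    closed = T-∧⁻ʳ {mem U zer} t
    add-closed = T-∧⁻ˡ closed
    smul-closed = T-∧⁻ʳ {all (λ x → all (λ y → mem U (add x y)) (members U)) (members U)} closed
    ∋add : ∀ {x y} → U ∋ x → U ∋ y → U ∋ add x y
    ∋add {x} {y} tx ty = ∋-resp U (eq-sym (add-cong (rep-ι x) (rep-ι y)))
      (all-sound _ (all-sound _ add-closed (rep-∈-members U x tx)) (rep-∈-members U y ty))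
    ∋smul : ∀ a {x} → U ∋ x → U ∋ smul a x
    ∋smul a {x} tx = let b , b∈ , a≈b = find (elements-complete a) in
      ∋-resp U (eq-sym (smul-cong a≈b (rep-ι x)))
        (all-sound _ (all-sound _ smul-closed b∈) (rep-∈-members U x tx))

  isSubspace-complete : ∀ U → IsSubspace U → T (isSubspace U)
  isSubspace-complete U s = T-∧⁺ ∋zer (T-∧⁺
    (all-complete _ (members U) λ x∈ → all-complete _ (members U) λ y∈ →
       ∋add (members-∋ U x∈) (members-∋ U y∈))
    (all-complete _ elements λ _ → all-complete _ (members U) λ x∈ → ∋smul _ (members-∋ U x∈)))
    where open IsSubspace s

  ∈-subspaces⁺ : ∀ {U} → IsSubspace U → U ∈ subspaces
  ∈-subspaces⁺ {U} s = ∈-filter⁺ (T? ∘ isSubspace) (allSubsets-complete N U) (isSubspace-complete U s)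

  ∈-subspaces⁻ : ∀ {U} → U ∈ subspaces → IsSubspace U
  ∈-subspaces⁻ {U} U∈ = isSubspace-sound U (proj₂ (∈-filter⁻ (T? ∘ isSubspace) {xs = allSubsets N} U∈))

  subspaces-unique : Unique subspaces
  subspaces-unique = Unique.filter⁺ (T? ∘ isSubspace) (allSubsets-unique N)

  zeroSub-⊆ : ∀ {U} → IsSubspace U → zeroSub ⊆ U
  zeroSub-⊆ {U} U-sub = ∋⇒⊆ zeroSub U λ x x∈0 →
    ∋-resp U (eq-sym (subst T (mem-zeroSub x) x∈0)) (IsSubspace.∋zer U-sub)

  private
    open MöbiusRecursion D using (strictlyBelow)
    _≟_ : DecidableEquality Sub
    _≟_ = Vec.≡-dec Bool._≟_

    ⊆-split : ∀ (g : Sub → ℤ) U {Z} → Z ∈ subspaces →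
              when (Z ⊆ᵇ U) (g Z) ≡ when ⌊ U ≟ Z ⌋ (g Z) + when (strictlyBelow U Z) (g Z)
    ⊆-split g U {Z} Z∈ with U ≟ Z
    ... | yes refl rewrite T⇒≡true (≡ᵛ-refl U) | ∧-zeroʳ (U ⊆ᵇ U) | ∧-zeroʳ (zeroSub ⊆ᵇ U)
                         | T⇒≡true (⊆ᵇ-complete U U (⊆-refl {U = U})) = sym (ℤ.+-identityʳ (g U))
    ... | no U≢Z rewrite T⇒≡true (⊆ᵇ-complete zeroSub Z (zeroSub-⊆ (∈-subspaces⁻ Z∈)))
                       | ¬T⇒≡false (U≢Z ∘ sym ∘ ≡ᵛ-sound Z U) | ∧-identityʳ (Z ⊆ᵇ U) = sym (ℤ.+-identityˡ _)

  μ-unique-⊆ : (g : Sub → ℤ) →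
    (∀ U → U ∈ subspaces → sumℤ (λ Z → when (Z ⊆ᵇ U) (g Z)) subspaces ≡ when (U ≡ᵛ zeroSub) 1ℤ) →
    ∀ U → U ∈ subspaces → μ zeroSub U ≡ g U
  μ-unique-⊆ g sum-⊆ = MöbiusRecursion.μ-unique D g λ U U∈ → begin
    g U + sumℤ g (filterᵇ (strictlyBelow U) subspaces)
      ≡⟨ cong₂ _+_ (sumℤ-indicator _≟_ g subspaces-unique U∈)
                   (sym (sumℤ-filter g (strictlyBelow U) subspaces)) ⟨
    sumℤ (λ Z → when ⌊ U ≟ Z ⌋ (g Z)) subspaces + sumℤ (λ Z → when (strictlyBelow U Z) (g Z)) subspaces
      ≡⟨ sumℤ-+ (λ Z → when ⌊ U ≟ Z ⌋ (g Z)) (λ Z → when (strictlyBelow U Z) (g Z)) subspaces ⟨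
    sumℤ (λ Z → when ⌊ U ≟ Z ⌋ (g Z) + when (strictlyBelow U Z) (g Z)) subspaces
      ≡⟨ sumℤ-cong subspaces (⊆-split g U) ⟨
    sumℤ (λ Z → when (Z ⊆ᵇ U) (g Z)) subspaces
      ≡⟨ sum-⊆ U U∈ ⟩
    when (U ≡ᵛ zeroSub) 1ℤ ∎
    where open ≡-Reasoning

module VectorSpace {F : FiniteField} (E : FinVectorSpace F) where
  open FinVectorSpace E
  open FiniteField F using (1#) renaming (-_ to -ᶠ_; _+_ to _+ᶠ_)
  module AG = AbelianGroupProperties +ᴹ-abelianGroup
  open CommutativeSemigroupProperties (AbelianGroup.commutativeSemigroup +ᴹ-abelianGroup)
    using () renaming (interchange to +ᴹ-interchange)

  diff-chain : ∀ x y z → (x +ᴹ -ᴹ y) +ᴹ (y +ᴹ -ᴹ z) ≈ᴹ x +ᴹ -ᴹ z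
  diff-chain x y z = begin
    (x +ᴹ -ᴹ y) +ᴹ (y +ᴹ -ᴹ z) ≈⟨ +ᴹ-assoc x (-ᴹ y) _ ⟩
    x +ᴹ (-ᴹ y +ᴹ (y +ᴹ -ᴹ z)) ≈⟨ +ᴹ-congˡ (+ᴹ-assoc (-ᴹ y) y _) ⟨
    x +ᴹ ((-ᴹ y +ᴹ y) +ᴹ -ᴹ z) ≈⟨ +ᴹ-congˡ (+ᴹ-congʳ (-ᴹ‿inverseˡ y)) ⟩
    x +ᴹ (0ᴹ +ᴹ -ᴹ z)          ≈⟨ +ᴹ-congˡ (+ᴹ-identityˡ _) ⟩
    x +ᴹ -ᴹ z                  ∎
    where open SetoidReasoning ≈ᴹ-setoid

  diff-+ : ∀ x y x′ y′ → (x +ᴹ y) +ᴹ -ᴹ (x′ +ᴹ y′) ≈ᴹ (x +ᴹ -ᴹ x′) +ᴹ (y +ᴹ -ᴹ y′)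
  diff-+ x y x′ y′ = ≈ᴹ-trans (+ᴹ-congˡ (≈ᴹ-sym (AG.⁻¹-∙-comm x′ y′))) (+ᴹ-interchange x y _ _)

  diff-diff : ∀ x r → x +ᴹ -ᴹ (x +ᴹ -ᴹ r) ≈ᴹ r
  diff-diff x r = begin
    x +ᴹ -ᴹ (x +ᴹ -ᴹ r) ≈⟨ +ᴹ-congˡ (AG.⁻¹-anti-homo‿- x r) ⟩
    x +ᴹ (r +ᴹ -ᴹ x)    ≈⟨ +ᴹ-comm x _ ⟩
    (r +ᴹ -ᴹ x) +ᴹ x    ≈⟨ +ᴹ-assoc r (-ᴹ x) x ⟩
    r +ᴹ (-ᴹ x +ᴹ x)    ≈⟨ +ᴹ-congˡ (-ᴹ‿inverseˡ x) ⟩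
    r +ᴹ 0ᴹ             ≈⟨ +ᴹ-identityʳ r ⟩
    r                   ∎
    where open SetoidReasoning ≈ᴹ-setoid

  diff-0 : ∀ x → x +ᴹ -ᴹ 0ᴹ ≈ᴹ x
  diff-0 x = ≈ᴹ-trans (+ᴹ-congˡ AG.ε⁻¹≈ε) (+ᴹ-identityʳ x)

  *ₗ-diff : ∀ a x y → a *ₗ (x +ᴹ -ᴹ y) ≈ᴹ a *ₗ x +ᴹ -ᴹ (a *ₗ y)
  *ₗ-diff a x y = ≈ᴹ-trans (*ₗ-distribˡ a x (-ᴹ y)) (+ᴹ-congˡ (AG.inverseˡ-unique _ _ (begin
    a *ₗ (-ᴹ y) +ᴹ a *ₗ y ≈⟨ *ₗ-distribˡ a (-ᴹ y) y ⟨
    a *ₗ (-ᴹ y +ᴹ y)      ≈⟨ *ₗ-congˡ (-ᴹ‿inverseˡ y) ⟩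
    a *ₗ 0ᴹ               ≈⟨ *ₗ-zeroʳ a ⟩
    0ᴹ                    ∎)))
    where open SetoidReasoning ≈ᴹ-setoid

  -1*ₗ : ∀ z → (-ᶠ 1#) *ₗ z ≈ᴹ -ᴹ z
  -1*ₗ z = AG.inverseˡ-unique _ _ (begin
    (-ᶠ 1#) *ₗ z +ᴹ z          ≈⟨ +ᴹ-congˡ (*ₗ-identityˡ z) ⟨
    (-ᶠ 1#) *ₗ z +ᴹ 1# *ₗ z    ≈⟨ *ₗ-distribʳ z (-ᶠ 1#) 1# ⟨
    ((-ᶠ 1#) +ᶠ 1#) *ₗ z       ≈⟨ *ₗ-congʳ (FiniteField.-‿inverseˡ F 1#) ⟩
    FiniteField.0# F *ₗ z     ≈⟨ *ₗ-zeroˡ z ⟩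
    0ᴹ                        ∎)
    where open SetoidReasoning ≈ᴹ-setoid

  ≈⇒eq : ∀ {x y} → x ≈ᴹ y → T ⌊ x ≟ᴹ y ⌋
  ≈⇒eq = fromWitness

  eq⇒≈ : ∀ {x y} → T ⌊ x ≟ᴹ y ⌋ → x ≈ᴹ y
  eq⇒≈ = toWitness

  wellFormed : IsWellFormed (toData E)
  wellFormed = record
    { eq-refl = λ _ → ≈⇒eq ≈ᴹ-refl
    ; eq-sym = λ t → ≈⇒eq (≈ᴹ-sym (eq⇒≈ t))
    ; eq-trans = λ s t → ≈⇒eq (≈ᴹ-trans (eq⇒≈ s) (eq⇒≈ t))
    ; reps-unique = AllPairs.map (λ x≉y → x≉y ∘ eq⇒≈) vectors-unique
    ; reps-complete = Any.map ≈⇒eq ∘ vectors-complete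
    ; add-cong = λ s t → ≈⇒eq (+ᴹ-cong (eq⇒≈ s) (eq⇒≈ t))
    ; smul-cong = λ a≈b t → ≈⇒eq (*ₗ-cong a≈b (eq⇒≈ t))
    }

  open WellFormed wellFormed public

  ∋-≈ : ∀ U {x y} → x ≈ᴹ y → U ∋ x → U ∋ y
  ∋-≈ U = ∋-resp U ∘ ≈⇒eq

  module _ {W : Sub} (W-sub : IsSubspace W) where
    open IsSubspace W-sub

    ∋neg : ∀ {x} → W ∋ x → W ∋ (-ᴹ x)
    ∋neg t = ∋-≈ W (-1*ₗ _) (∋smul (-ᶠ 1#) t)

    ∋diff : ∀ {x y} → W ∋ x → W ∋ y → W ∋ (x +ᴹ -ᴹ y)
    ∋diff tx ty = ∋add tx (∋neg ty)

module Quotient {F : FiniteField} (E : FinVectorSpace F) (V : QSub E) (V-sub : T (isSubspaceE E V)) where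
  open FinVectorSpace E
  module ambient = VectorSpace E
  open ambient using (_∋_; ∋-≈; diff-0)

  V-subspace : ambient.IsSubspace V
  V-subspace = ambient.isSubspace-sound V V-sub

  open ambient.IsSubspace V-subspace

  eqV : Carrierᴹ → Carrierᴹ → Bool
  eqV = SpaceData.eq (quotientData E V)

  eqV-refl : ∀ x → T (eqV x x)
  eqV-refl x = ∋-≈ V (≈ᴹ-sym (-ᴹ‿inverseʳ x)) ∋zer

  eqV-sym : ∀ {x y} → T (eqV x y) → T (eqV y x)
  eqV-sym {x} {y} t = ∋-≈ V (ambient.AG.⁻¹-anti-homo‿- x y) (ambient.∋neg V-subspace t)

  eqV-trans : ∀ {x y z} → T (eqV x y) → T (eqV y z) → T (eqV x z)
  eqV-trans {x} {y} {z} s t = ∋-≈ V (ambient.diff-chain x y z) (∋add s t)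

  ≈⇒eqV : ∀ {x y} → x ≈ᴹ y → T (eqV x y)
  ≈⇒eqV {x} {y} x≈y = ∋-≈ V (≈ᴹ-sym (≈ᴹ-trans (+ᴹ-congʳ x≈y) (-ᴹ‿inverseʳ y))) ∋zer

  private
    cosetDecSetoid : DecSetoid 0ℓ 0ℓ
    cosetDecSetoid = record
      { Carrier = Carrierᴹ
      ; _≈_ = λ x y → T (eqV x y)
      ; isDecEquivalence = record
        { isEquivalence = record { refl = eqV-refl _ ; sym = eqV-sym ; trans = eqV-trans }
        ; _≟_ = λ x y → T? (eqV x y) } }

  wellFormed : IsWellFormed (quotientData E V)
  wellFormed = record
    { eq-refl = eqV-refl
    ; eq-sym = eqV-sym
    ; eq-trans = eqV-trans
    ; reps-unique = deduplicate-! cosetDecSetoid vectors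
    ; reps-complete = λ x →
        Any.deduplicate⁺ (λ x y → T? (eqV x y)) (λ y~x x~z → eqV-trans x~z (eqV-sym y~x))
                         (Any.map ≈⇒eqV (vectors-complete x))
    ; add-cong = λ {x} {x′} {y} {y′} s t → ∋-≈ V (≈ᴹ-sym (ambient.diff-+ x y x′ y′)) (∋add s t)
    ; smul-cong = λ {a} {b} {x} {y} a≈b t →
        ∋-≈ V (≈ᴹ-trans (ambient.*ₗ-diff a x y) (+ᴹ-congˡ (-ᴹ‿cong (*ₗ-cong a≈b ≈ᴹ-refl)))) (∋smul a t)
    }

  module quotient = WellFormed wellFormed

  preimage : quotient.Sub → ambient.Sub
  preimage = QMat.preimage E V

  image : ambient.Sub → quotient.Sub
  image W = Vec.map (ambient.mem W) quotient.repv

  Saturated : ambient.Sub → Set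
  Saturated W = ∀ {x y} → T (eqV x y) → W ∋ x → W ∋ y

  mem-preimage : ∀ U x → ambient.mem (preimage U) x ≡ quotient.mem U x
  mem-preimage U = ambient.mem-tabulate (quotient.mem U) (quotient.mem-cong U ∘ ≈⇒eqV ∘ ambient.eq⇒≈)

  mem-image : ∀ W → Saturated W → ∀ x → quotient.mem (image W) x ≡ ambient.mem W x
  mem-image W sat = quotient.mem-tabulate (ambient.mem W) (λ x~y → T-ext (sat x~y) (sat (eqV-sym x~y)))

  ⊇V⇒saturated : ∀ {W} → ambient.IsSubspace W → V ⊆ W → Saturated W
  ⊇V⇒saturated {W} W-sub V⊆W {x} {y} x~y x∈W =
    ∋-≈ W (ambient.diff-diff x y) (ambient.∋diff W-sub x∈W (ambient.⊆⇒∋ V W V⊆W _ x~y))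

  V⊆preimage : ∀ U → quotient.IsSubspace U → V ⊆ preimage U
  V⊆preimage U U-sub = ambient.∋⇒⊆ V (preimage U) λ x x∈V → subst T (sym (mem-preimage U x))
    (quotient.∋-resp U (eqV-sym (∋-≈ V (≈ᴹ-sym (diff-0 x)) x∈V)) (quotient.IsSubspace.∋zer U-sub))

  preimage-subspace : ∀ U → quotient.IsSubspace U → ambient.IsSubspace (preimage U)
  preimage-subspace U U-sub = record
    { ∋zer = from ∋zer′
    ; ∋add = λ s t → from (∋add′ (to s) (to t))
    ; ∋smul = λ a t → from (∋smul′ a (to t)) }
    where
    open quotient.IsSubspace U-sub renaming (∋zer to ∋zer′; ∋add to ∋add′; ∋smul to ∋smul′)
    to : ∀ {x} → preimage U ∋ x → quotient._∋_ U x
    to = subst T (mem-preimage U _)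
    from : ∀ {x} → quotient._∋_ U x → preimage U ∋ x
    from = subst T (sym (mem-preimage U _))

  image-subspace : ∀ W → ambient.IsSubspace W → V ⊆ W → quotient.IsSubspace (image W)
  image-subspace W W-sub V⊆W = record
    { ∋zer = from ∋zer′
    ; ∋add = λ s t → from (∋add′ (to s) (to t))
    ; ∋smul = λ a t → from (∋smul′ a (to t)) }
    where
    open ambient.IsSubspace W-sub renaming (∋zer to ∋zer′; ∋add to ∋add′; ∋smul to ∋smul′)
    sat = ⊇V⇒saturated W-sub V⊆W
    to : ∀ {x} → quotient._∋_ (image W) x → W ∋ x
    to = subst T (mem-image W sat _)
    from : ∀ {x} → W ∋ x → quotient._∋_ (image W) x
    from = subst T (sym (mem-image W sat _))

  preimage-image : ∀ W → Saturated W → preimage (image W) ≡ W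
  preimage-image W sat = ambient.∋-ext (preimage (image W)) W
    (λ x → subst T (trans (mem-preimage (image W) x) (mem-image W sat x)))
    (λ x → subst T (sym (trans (mem-preimage (image W) x) (mem-image W sat x))))

  image-⊆⇒⊆-preimage : ∀ W U → Saturated W → image W ⊆ U → W ⊆ preimage U
  image-⊆⇒⊆-preimage W U sat W′⊆U = ambient.∋⇒⊆ W (preimage U) λ x x∈W →
    subst T (sym (mem-preimage U x))
      (quotient.⊆⇒∋ (image W) U W′⊆U x (subst T (sym (mem-image W sat x)) x∈W))

  ⊆-preimage⇒image-⊆ : ∀ W U → Saturated W → W ⊆ preimage U → image W ⊆ U
  ⊆-preimage⇒image-⊆ W U sat W⊆U′ = quotient.∋⇒⊆ (image W) U λ x x∈W′ →
    subst T (mem-preimage U x)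
      (ambient.⊆⇒∋ W (preimage U) W⊆U′ x (subst T (mem-image W sat x) x∈W′))

  mem-zeroSub≡V : ∀ x → quotient.mem quotient.zeroSub x ≡ ambient.mem V x
  mem-zeroSub≡V x = trans (quotient.mem-zeroSub x) (T-ext (∋-≈ V (diff-0 x)) (∋-≈ V (≈ᴹ-sym (diff-0 x))))

  preimage-zeroSub : preimage quotient.zeroSub ≡ V
  preimage-zeroSub = ambient.∋-ext (preimage quotient.zeroSub) V
    (λ x → subst T (trans (mem-preimage quotient.zeroSub x) (mem-zeroSub≡V x)))
    (λ x → subst T (sym (trans (mem-preimage quotient.zeroSub x) (mem-zeroSub≡V x))))

  preimage-fullSub : preimage quotient.fullSub ≡ ambient.fullSub
  preimage-fullSub = ambient.∋-ext (preimage quotient.fullSub) ambient.fullSub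
    (λ x _ → ambient.fullSub-∋ x)
    (λ x _ → subst T (sym (mem-preimage quotient.fullSub x)) (quotient.fullSub-∋ x))

module Projective {F : FiniteField} (E : FinVectorSpace F) where
  open FinVectorSpace E
  open FiniteField F using (elements; elements-complete; 1#)
  open VectorSpace E
  open QMat E using (line; points; pointv; unionLines; projSub; nonzeroVecs; m)

  point : Fin m → Sub
  point = lookup pointv

  private
    onLine : Carrierᴹ → Carrierᴹ → Bool
    onLine v x = any (λ a → ⌊ x ≟ᴹ (a *ₗ v) ⌋) elements

    onLine⁺ : ∀ v x a → x ≈ᴹ a *ₗ v → T (onLine v x)
    onLine⁺ v x a x≈av = let b , b∈ , a≈b = find (elements-complete a) in
      Any.any⁺ _ (lose b∈ (≈⇒eq (≈ᴹ-trans x≈av (*ₗ-cong a≈b ≈ᴹ-refl))))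

    onLine⁻ : ∀ v x → T (onLine v x) → ∃[ a ] x ≈ᴹ a *ₗ v
    onLine⁻ v x t = let a , _ , x≈av = find (Any.any⁻ _ elements t) in a , eq⇒≈ x≈av

    mem-line : ∀ v x → mem (line v) x ≡ onLine v x
    mem-line v = mem-tabulate (onLine v) λ {x} {y} x~y → T-ext (move x~y) (move (eq-sym x~y))
      where
      move : ∀ {x y} → T ⌊ x ≟ᴹ y ⌋ → T (onLine v x) → T (onLine v y)
      move {x} {y} x~y t = let a , x≈av = onLine⁻ v x t in
        onLine⁺ v y a (≈ᴹ-trans (≈ᴹ-sym (eq⇒≈ x~y)) x≈av)

  ∋line⁺ : ∀ v {x} a → x ≈ᴹ a *ₗ v → line v ∋ x
  ∋line⁺ v {x} a x≈av = subst T (sym (mem-line v x)) (onLine⁺ v x a x≈av)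

  ∋line⁻ : ∀ v {x} → line v ∋ x → ∃[ a ] x ≈ᴹ a *ₗ v
  ∋line⁻ v {x} t = onLine⁻ v x (subst T (mem-line v x) t)

  line-∋self : ∀ v → line v ∋ v
  line-∋self v = ∋line⁺ v 1# (≈ᴹ-sym (*ₗ-identityˡ v))

  line-⊆ : ∀ {W} → IsSubspace W → ∀ {v} → W ∋ v → line v ⊆ W
  line-⊆ {W} W-sub {v} v∈W = ∋⇒⊆ (line v) W λ x x∈ℓ →
    let a , x≈av = ∋line⁻ v x∈ℓ in ∋-≈ W (≈ᴹ-sym x≈av) (IsSubspace.∋smul W-sub a v∈W)

  line-cong : ∀ {v w} → v ≈ᴹ w → line v ≡ line w
  line-cong {v} {w} v≈w = ∋-ext (line v) (line w)
    (λ x t → let a , x≈av = ∋line⁻ v t in ∋line⁺ w a (≈ᴹ-trans x≈av (*ₗ-congˡ v≈w)))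
    (λ x t → let a , x≈aw = ∋line⁻ w t in ∋line⁺ v a (≈ᴹ-trans x≈aw (*ₗ-congˡ (≈ᴹ-sym v≈w))))

  ≉0⇒nonzero : ∀ {v} → ¬ (v ≈ᴹ 0ᴹ) → ∃[ w ] (w ∈ nonzeroVecs × v ≈ᴹ w)
  ≉0⇒nonzero {v} v≉0 = let w , w∈ , v≈w = find (vectors-complete v) in
    w , ∈-filter⁺ _ w∈ (T-not⁺ (v≉0 ∘ ≈ᴹ-trans v≈w ∘ eq⇒≈)) , v≈w

  point⇒line : ∀ i → ∃[ v ] (v ∈ nonzeroVecs × point i ≡ line v)
  point⇒line i = ∈-map⁻ line (∈-deduplicate⁻ (λ U W → T? (U ≡ᵛ W)) (List.map line nonzeroVecs)
                                               (lookup-fromList-∈ points i))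

  line⇒point : ∀ {v} → ¬ (v ≈ᴹ 0ᴹ) → ∃[ i ] (point i ≡ line v)
  line⇒point {v} v≉0 = Any.index on-points , lookup-fromList-index on-points
    where
    on-points : Any (_≡ line v) points
    on-points = let w , w∈ , v≈w = ≉0⇒nonzero v≉0 in
      Any.deduplicate⁺ (λ U W → T? (U ≡ᵛ W)) (λ W≡U U≡ℓ → trans (≡ᵛ-sound _ _ W≡U) U≡ℓ)
        (Any.map (λ { refl → line-cong (≈ᴹ-sym v≈w) }) (∈-map⁺ line {xs = nonzeroVecs} w∈))

  private
    selected : Vec Bool m → Vec Sub m
    selected S = Vec.zipWith (λ b ℓ → if b then ℓ else Vec.replicate N false) S pointv

    lookup-if : ∀ b (ℓ : Sub) j → lookup (if b then ℓ else Vec.replicate N false) j ≡ b ∧ lookup ℓ j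
    lookup-if true ℓ j = refl
    lookup-if false ℓ j = Vec.lookup-replicate j false

    lookup-unionLines : ∀ S j i →
      lookup (Vec.map (λ ℓ → lookup ℓ j) (selected S)) i ≡ lookup S i ∧ lookup (point i) j
    lookup-unionLines S j i = trans (Vec.lookup-map i (λ ℓ → lookup ℓ j) (selected S))
      (trans (cong (λ ℓ → lookup ℓ j) (Vec.lookup-zipWith _ i S pointv)) (lookup-if (lookup S i) (point i) j))

    column : Vec Bool m → Carrierᴹ → Vec Bool m
    column S x = Vec.map (λ ℓ → lookup ℓ (ι x)) (selected S)

    mem-unionLines : ∀ S x → mem (unionLines S) x ≡ anyᵛ (column S x)
    mem-unionLines S x = trans (mem-ι (unionLines S) x) (anyᵛ-lookup-⋃ (selected S) (ι x))

  ∋unionLines⁻ : ∀ S x → unionLines S ∋ x → ∃[ i ] (T (lookup S i) × point i ∋ x)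
  ∋unionLines⁻ S x t =
    let i , t′ = anyᵛ-sound (column S x) (subst T (mem-unionLines S x) t)
        t″ = subst T (lookup-unionLines S (ι x) i) t′
    in i , T-∧⁻ˡ t″ , subst T (sym (mem-ι (point i) x)) (T-∧⁻ʳ {lookup S i} t″)

  ∋unionLines⁺ : ∀ S x i → T (lookup S i) → point i ∋ x → unionLines S ∋ x
  ∋unionLines⁺ S x i i∈S x∈i = subst T (sym (mem-unionLines S x)) (anyᵛ-complete (column S x) i
    (subst T (sym (lookup-unionLines S (ι x) i)) (T-∧⁺ i∈S (subst T (mem-ι (point i) x) x∈i))))

  ∩-subspace : ∀ {U W} → IsSubspace U → IsSubspace W → IsSubspace (U ∩ᵛ W)
  ∩-subspace {U} {W} U-sub W-sub = record
    { ∋zer = join (U.∋zer , W.∋zer)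
    ; ∋add = λ s t → let su , sw = split s ; tu , tw = split t in join (U.∋add su tu , W.∋add sw tw)
    ; ∋smul = λ a t → let tu , tw = split t in join (U.∋smul a tu , W.∋smul a tw) }
    where
    module U = IsSubspace U-sub
    module W = IsSubspace W-sub
    split : ∀ {x} → (U ∩ᵛ W) ∋ x → U ∋ x × W ∋ x
    split {x} t = let t′ = subst T (mem-∩ U W x) t in T-∧⁻ˡ t′ , T-∧⁻ʳ {mem U x} t′
    join : ∀ {x} → U ∋ x × W ∋ x → (U ∩ᵛ W) ∋ x
    join {x} (tu , tw) = subst T (sym (mem-∩ U W x)) (T-∧⁺ tu tw)

  fullSub-subspace : IsSubspace fullSub
  fullSub-subspace = record { ∋zer = fullSub-∋ _ ; ∋add = λ _ _ → fullSub-∋ _ ; ∋smul = λ _ _ → fullSub-∋ _ }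

  private
    spanWithin : Sub → List Sub → Sub
    spanWithin X = List.foldr (λ U acc → if X ⊆ᵇ U then U ∩ᵛ acc else acc) fullSub

    spanWithin-subspace : ∀ X Us → (∀ {U} → U ∈ Us → IsSubspace U) → IsSubspace (spanWithin X Us)
    spanWithin-subspace X [] _ = fullSub-subspace
    spanWithin-subspace X (U ∷ Us) Us-sub with X ⊆ᵇ U
    ... | true = ∩-subspace (Us-sub (here refl)) (spanWithin-subspace X Us (Us-sub ∘ there))
    ... | false = spanWithin-subspace X Us (Us-sub ∘ there)

    ⊆-spanWithin : ∀ X Us → X ⊆ spanWithin X Us
    ⊆-spanWithin X [] i _ = T-lookup-replicate i
    ⊆-spanWithin X (U ∷ Us) i t with X ⊆ᵇ U in X⊆U
    ... | true = subst T (sym (Vec.lookup-zipWith _∧_ i U (spanWithin X Us)))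
                   (T-∧⁺ (⊆ᵇ-sound X U (subst T (sym X⊆U) _) i t) (⊆-spanWithin X Us i t))
    ... | false = ⊆-spanWithin X Us i t

    spanWithin-least : ∀ X Us {W} → W ∈ Us → X ⊆ W → spanWithin X Us ⊆ W
    spanWithin-least X (U ∷ Us) (here refl) X⊆U i t with X ⊆ᵇ U in X⊆ᵇU
    ... | true = T-∧⁻ˡ (subst T (Vec.lookup-zipWith _∧_ i U (spanWithin X Us)) t)
    ... | false = ⊥-elim (subst T X⊆ᵇU (⊆ᵇ-complete X U X⊆U))
    spanWithin-least X (U ∷ Us) (there W∈) X⊆W i t with X ⊆ᵇ U
    ... | true = spanWithin-least X Us W∈ X⊆W i
                   (T-∧⁻ʳ {lookup U i} (subst T (Vec.lookup-zipWith _∧_ i U (spanWithin X Us)) t))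
    ... | false = spanWithin-least X Us W∈ X⊆W i t

  span-subspace : ∀ X → IsSubspace (span X)
  span-subspace X = spanWithin-subspace X subspaces ∈-subspaces⁻

  ⊆-span : ∀ X → X ⊆ span X
  ⊆-span X = ⊆-spanWithin X subspaces

  span-least : ∀ X {W} → IsSubspace W → X ⊆ W → span X ⊆ W
  span-least X W-sub = spanWithin-least X subspaces (∈-subspaces⁺ W-sub)

  closure : Vec Bool m → Sub
  closure S = span (unionLines S)

  closure-subspace : ∀ S → IsSubspace (closure S)
  closure-subspace S = span-subspace (unionLines S)

  point-⊆-closure : ∀ S i → T (lookup S i) → point i ⊆ closure S
  point-⊆-closure S i i∈S = ∋⇒⊆ (point i) (closure S) λ x x∈i →
    ⊆⇒∋ (unionLines S) (closure S) (⊆-span (unionLines S)) x (∋unionLines⁺ S x i i∈S x∈i)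

  closure-least : ∀ S {W} → IsSubspace W → (∀ i → T (lookup S i) → point i ⊆ W) → closure S ⊆ W
  closure-least S {W} W-sub points⊆W = span-least (unionLines S) W-sub
    (∋⇒⊆ (unionLines S) W λ x t → let i , i∈S , x∈i = ∋unionLines⁻ S x t in
                                  ⊆⇒∋ (point i) W (points⊆W i i∈S) x x∈i)

  ∋closure : ∀ S x → (¬ (x ≈ᴹ 0ᴹ) → ∀ i → point i ≡ line x → T (lookup S i)) → closure S ∋ x
  ∋closure S x on-S with x ≟ᴹ 0ᴹ
  ... | yes x≈0 = ∋-≈ (closure S) (≈ᴹ-sym x≈0) (IsSubspace.∋zer (closure-subspace S))
  ... | no x≉0 = let i , i≡x = line⇒point x≉0 in
    ⊆⇒∋ (point i) (closure S) (point-⊆-closure S i (on-S x≉0 i i≡x)) x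
        (subst (_∋ x) (sym i≡x) (line-∋self x))

  closure-all : closure (Vec.replicate m true) ≡ fullSub
  closure-all = ⊆-antisym {U = closure all-points} (λ i _ → T-lookup-replicate i)
    (∋⇒⊆ fullSub (closure all-points) λ x _ → ∋closure all-points x (λ _ i _ → T-lookup-replicate i))
    where all-points = Vec.replicate m true

  projSub-∋ : ∀ W i {v} → v ∈ nonzeroVecs → W ∋ v → point i ≡ line v → T (lookup (projSub W) i)
  projSub-∋ W i v∈ v∈W i≡v = subst T (sym (Vec.lookup-map i _ pointv))
    (Any.any⁺ _ (lose v∈ (T-∧⁺ v∈W (≡⇒≡ᵛ (sym i≡v)))))

  projSub-sound : ∀ {W} → IsSubspace W → ∀ i → T (lookup (projSub W) i) → point i ⊆ W
  projSub-sound {W} W-sub i t =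
    let v , _ , t′ = find (Any.any⁻ _ nonzeroVecs (subst T (Vec.lookup-map i _ pointv) t)) in
    subst (_⊆ W) (≡ᵛ-sound (line v) (point i) (T-∧⁻ʳ {mem W v} t′)) (line-⊆ W-sub (T-∧⁻ˡ t′))

  projSub-complete : ∀ W {v} → W ∋ v → ¬ (v ≈ᴹ 0ᴹ) → ∀ i → point i ≡ line v → T (lookup (projSub W) i)
  projSub-complete W v∈W v≉0 i i≡v = let w , w∈ , v≈w = ≉0⇒nonzero v≉0 in
    projSub-∋ W i w∈ (∋-≈ W v≈w v∈W) (trans i≡v (line-cong v≈w))

  ⊆-closure : ∀ W S → projSub W ⊆ S → W ⊆ closure S
  ⊆-closure W S P⊆S = ∋⇒⊆ W (closure S) λ x x∈W → ∋closure S x λ x≉0 i i≡x →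
    P⊆S i (projSub-complete W x∈W x≉0 i i≡x)

  closure-projSub : ∀ {W} → IsSubspace W → closure (projSub W) ≡ W
  closure-projSub {W} W-sub = ⊆-antisym (closure-least (projSub W) W-sub (projSub-sound W-sub))
                                        (⊆-closure W (projSub W) (λ _ t → t))

module Contraction {F : FiniteField} (E : FinVectorSpace F) (ρ : QSub E → ℕ)
                   (V : QSub E) (V-sub : T (isSubspaceE E V)) where
  open FinVectorSpace E
  open Quotient E V V-sub
  open Projective E
  open ambient using (_∋_; ⊆⇒∋; ∋⇒⊆; ∋-≈)
  open QMat E using (line; projSub; nonzeroVecs; m)

  _≟_ : DecidableEquality quotient.Sub
  _≟_ = Vec.≡-dec Bool._≟_

  PV : Vec Bool m
  PV = projSub V

  M/PV : SetRank m
  M/PV = contract (projectivization E ρ) PV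

  ground : Vec Bool m
  ground = SetRank.ground M/PV

  groundSubsets : List (Vec Bool m)
  groundSubsets = filterᵇ (_⊆ᵇ ground) (allSubsets m)

  private
    lookup-ground : ∀ i → lookup ground i ≡ not (lookup PV i)
    lookup-ground i = trans (Vec.lookup-zipWith _∧_ i (Vec.replicate m true) (complᵛ PV))
                            (cong₂ _∧_ (Vec.lookup-replicate i true) (Vec.lookup-map i not PV))

  ground⁺ : ∀ {i} → ¬ T (lookup PV i) → T (lookup ground i)
  ground⁺ {i} i∉PV = subst T (sym (lookup-ground i)) (T-not⁺ i∉PV)

  ground⁻ : ∀ {i} → T (lookup ground i) → ¬ T (lookup PV i)
  ground⁻ {i} t = T-not⁻ (subst T (lookup-ground i) t)

  PV⊆A∪PV : ∀ A → PV ⊆ (A ∪ᵛ PV)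
  PV⊆A∪PV A i t = subst T (sym (Vec.lookup-zipWith _∨_ i A PV)) (T-∨⁺ʳ {lookup A i} t)

  A⊆A∪PV : ∀ A → A ⊆ (A ∪ᵛ PV)
  A⊆A∪PV A i t = subst T (sym (Vec.lookup-zipWith _∨_ i A PV)) (T-∨⁺ˡ t)

  V⊆closure : ∀ A → V ⊆ closure (A ∪ᵛ PV)
  V⊆closure A = ⊆-closure V (A ∪ᵛ PV) (PV⊆A∪PV A)

  closure-saturated : ∀ A → Saturated (closure (A ∪ᵛ PV))
  closure-saturated A = ⊇V⇒saturated (closure-subspace (A ∪ᵛ PV)) (V⊆closure A)

  flat : Vec Bool m → quotient.Sub
  flat A = image (closure (A ∪ᵛ PV))

  flat-∈ : ∀ A → flat A ∈ quotient.subspaces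
  flat-∈ A = quotient.∈-subspaces⁺
    (image-subspace (closure (A ∪ᵛ PV)) (closure-subspace (A ∪ᵛ PV)) (V⊆closure A))

  preimage-flat : ∀ A → preimage (flat A) ≡ closure (A ∪ᵛ PV)
  preimage-flat A = preimage-image (closure (A ∪ᵛ PV)) (closure-saturated A)

  signedFibre : quotient.Sub → ℤ
  signedFibre U = sumℤ (sign ∘ card) (fibre _≟_ flat groundSubsets U)

  pointsIn : quotient.Sub → Vec Bool m
  pointsIn U = ground ∩ᵛ Vec.map (_⊆ᵇ preimage U) (QMat.pointv E)

  pointsIn⁺ : ∀ U {i} → ¬ T (lookup PV i) → point i ⊆ preimage U → T (lookup (pointsIn U) i)
  pointsIn⁺ U {i} i∉PV i⊆U = subst T (sym (Vec.lookup-zipWith _∧_ i ground _))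
    (T-∧⁺ (ground⁺ i∉PV) (subst T (sym (Vec.lookup-map i (_⊆ᵇ preimage U) (QMat.pointv E)))
                                (⊆ᵇ-complete (point i) (preimage U) i⊆U)))

  pointsIn⁻ : ∀ U {i} → T (lookup (pointsIn U) i) → ¬ T (lookup PV i) × point i ⊆ preimage U
  pointsIn⁻ U {i} t = let t′ = subst T (Vec.lookup-zipWith _∧_ i ground _) t in
    ground⁻ (T-∧⁻ˡ t′) ,
    ⊆ᵇ-sound (point i) (preimage U)
      (subst T (Vec.lookup-map i (_⊆ᵇ preimage U) (QMat.pointv E)) (T-∧⁻ʳ {lookup ground i} t′))

  flat-⊆ : ∀ U → quotient.IsSubspace U → ∀ A →
           (A ⊆ᵇ ground) ∧ (flat A ⊆ᵇ U) ≡ A ⊆ᵇ pointsIn U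
  flat-⊆ U U-sub A = T-ext to from
    where
    to : T ((A ⊆ᵇ ground) ∧ (flat A ⊆ᵇ U)) → T (A ⊆ᵇ pointsIn U)
    to t = ⊆ᵇ-complete A (pointsIn U) λ i i∈A →
      pointsIn⁺ U (ground⁻ (⊆ᵇ-sound A ground (T-∧⁻ˡ t) i i∈A))
        (⊆-trans {U = point i} {closure (A ∪ᵛ PV)} {preimage U}
                 (point-⊆-closure (A ∪ᵛ PV) i (A⊆A∪PV A i i∈A)) closure⊆U)
      where
      closure⊆U : closure (A ∪ᵛ PV) ⊆ preimage U
      closure⊆U = image-⊆⇒⊆-preimage (closure (A ∪ᵛ PV)) U (closure-saturated A)
                                       (⊆ᵇ-sound (flat A) U (T-∧⁻ʳ {A ⊆ᵇ ground} t))
    from : T (A ⊆ᵇ pointsIn U) → T ((A ⊆ᵇ ground) ∧ (flat A ⊆ᵇ U))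
    from t = T-∧⁺ (⊆ᵇ-complete A ground λ i i∈A → ground⁺ (proj₁ (pointsIn⁻ U (A⊆P i i∈A))))
                  (⊆ᵇ-complete (flat A) U (⊆-preimage⇒image-⊆ (closure (A ∪ᵛ PV)) U (closure-saturated A)
                    (closure-least (A ∪ᵛ PV) (preimage-subspace U U-sub) points⊆U)))
      where
      A⊆P = ⊆ᵇ-sound A (pointsIn U) t
      points⊆U : ∀ i → T (lookup (A ∪ᵛ PV) i) → point i ⊆ preimage U
      points⊆U i t with T-∨⁻ {lookup A i} (subst T (Vec.lookup-zipWith _∨_ i A PV) t)
      ... | inj₁ i∈A = proj₂ (pointsIn⁻ U (A⊆P i i∈A))
      ... | inj₂ i∈PV = ⊆-trans {U = point i} {V} {preimage U}
                                (projSub-sound V-subspace i i∈PV) (V⊆preimage U U-sub)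

  no-pointsIn-0 : ∀ i → ¬ T (lookup (pointsIn quotient.zeroSub) i)
  no-pointsIn-0 i t =
    let i∉PV , i⊆0 = pointsIn⁻ quotient.zeroSub t
        v , v∈ , i≡v = point⇒line i
        v∈V = ⊆⇒∋ (point i) V (subst (point i ⊆_) preimage-zeroSub i⊆0) v
                  (subst (_∋ v) (sym i≡v) (line-∋self v))
    in i∉PV (projSub-∋ V i v∈ v∈V i≡v)

  pointsIn-nonempty : ∀ U → quotient.IsSubspace U → U ≢ quotient.zeroSub → ∃[ i ] T (lookup (pointsIn U) i)
  pointsIn-nonempty U U-sub U≢0 =
    i , pointsIn⁺ U i∉PV (subst (_⊆ preimage U) (sym i≡x) (line-⊆ (preimage-subspace U U-sub) x∈U))
    where
    witness = ⊈-witness U quotient.zeroSub (λ U⊆0 → U≢0 (⊆-antisym {U = U} U⊆0 (quotient.zeroSub-⊆ U-sub)))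
    j = proj₁ witness
    x = quotient.rep j
    x∈U : preimage U ∋ x
    x∈U = subst T (sym (trans (mem-preimage U x) (quotient.mem-rep U j))) (proj₁ (proj₂ witness))
    x∉V : ¬ V ∋ x
    x∉V x∈V = proj₂ (proj₂ witness)
      (subst T (trans (sym (mem-zeroSub≡V x)) (quotient.mem-rep quotient.zeroSub j)) x∈V)
    x≉0 : ¬ (x ≈ᴹ 0ᴹ)
    x≉0 x≈0 = x∉V (∋-≈ V (≈ᴹ-sym x≈0) (ambient.IsSubspace.∋zer V-subspace))
    i = proj₁ (line⇒point x≉0)
    i≡x = proj₂ (line⇒point x≉0)
    i∉PV : ¬ T (lookup PV i)
    i∉PV i∈PV = x∉V (⊆⇒∋ (point i) V (projSub-sound V-subspace i i∈PV) x
                         (subst (_∋ x) (sym i≡x) (line-∋self x)))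

  pointsIn-empty : ∀ U → quotient.IsSubspace U → not (anyᵛ (pointsIn U)) ≡ (U ≡ᵛ quotient.zeroSub)
  pointsIn-empty U U-sub with U ≡ᵛ quotient.zeroSub in U≟0
  ... | true = cong not (¬T⇒≡false λ t →
        let i , ti = anyᵛ-sound (pointsIn U) t
            U≡0 = ≡ᵛ-sound U quotient.zeroSub (subst T (sym U≟0) _)
        in no-pointsIn-0 i (subst (λ W → T (lookup (pointsIn W) i)) U≡0 ti))
  ... | false = let i , ti = pointsIn-nonempty U U-sub (λ U≡0 → subst T U≟0 (≡⇒≡ᵛ U≡0)) in
        cong not (T⇒≡true (anyᵛ-complete (pointsIn U) i ti))

  signedFibre-sum-⊆ : ∀ U → U ∈ quotient.subspaces →
    sumℤ (λ Z → when (Z ⊆ᵇ U) (signedFibre Z)) quotient.subspaces ≡ when (U ≡ᵛ quotient.zeroSub) 1ℤ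
  signedFibre-sum-⊆ U U∈ = begin
    sumℤ (λ Z → when (Z ⊆ᵇ U) (signedFibre Z)) quotient.subspaces
      ≡⟨ sumℤ-cong quotient.subspaces (λ {Z} _ → restrict Z) ⟩
    sumℤ (λ Z → sumℤ below-U (fibre _≟_ flat groundSubsets Z)) quotient.subspaces
      ≡⟨ sumℤ-fibres _≟_ below-U flat groundSubsets quotient.subspaces-unique (λ {A} _ → flat-∈ A) ⟨
    sumℤ below-U groundSubsets
      ≡⟨ sumℤ-filter below-U (_⊆ᵇ ground) (allSubsets m) ⟩
    sumℤ (λ A → when (A ⊆ᵇ ground) (below-U A)) (allSubsets m)
      ≡⟨ sumℤ-cong (allSubsets m) (λ {A} _ → trans (when-∧ (A ⊆ᵇ ground) (flat A ⊆ᵇ U) (sign (card A)))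
                                                    (cong (λ b → when b (sign (card A))) (flat-⊆ U U-sub A))) ⟩
    sumℤ (λ A → when (A ⊆ᵇ pointsIn U) (sign (card A))) (allSubsets m)
      ≡⟨ alternating-sum-subsets m (pointsIn U) ⟩
    when (not (anyᵛ (pointsIn U))) 1ℤ
      ≡⟨ cong (λ b → when b 1ℤ) (pointsIn-empty U U-sub) ⟩
    when (U ≡ᵛ quotient.zeroSub) 1ℤ ∎
    where
    open ≡-Reasoning
    U-sub = quotient.∈-subspaces⁻ U∈
    below-U : Vec Bool m → ℤ
    below-U A = when (flat A ⊆ᵇ U) (sign (card A))
    restrict : ∀ Z → when (Z ⊆ᵇ U) (signedFibre Z) ≡ sumℤ below-U (fibre _≟_ flat groundSubsets Z)
    restrict Z = trans (when-sumℤ (Z ⊆ᵇ U) (sign ∘ card) (fibre _≟_ flat groundSubsets Z))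
      (sumℤ-cong _ λ {A} A∈ → cong (λ X → when (X ⊆ᵇ U) (sign (card A)))
                                   (sym (proj₂ (fibre-∈⁻ _≟_ flat groundSubsets A∈))))

  μ≡signedFibre : ∀ U → U ∈ quotient.subspaces → quotient.μ quotient.zeroSub U ≡ signedFibre U
  μ≡signedFibre = quotient.μ-unique-⊆ signedFibre signedFibre-sum-⊆

  matroidCorank : Vec Bool m → ℕ
  matroidCorank A = SetRank.rank M/PV ground ∸ SetRank.rank M/PV A

  qCorank : quotient.Sub → ℕ
  qCorank U = QMat.contractRank E ρ V quotient.fullSub ∸ QMat.contractRank E ρ V U

  matroidCorank≡qCorank-flat : ∀ A → matroidCorank A ≡ qCorank (flat A)
  matroidCorank≡qCorank-flat A = cong₂ _∸_ (cong₂ _∸_ (cong ρ closure-ground) (cong ρ closure-PV))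
                                            (cong₂ _∸_ (cong ρ (sym (preimage-flat A))) (cong ρ closure-PV))
    where
    closure-PV : closure PV ≡ V
    closure-PV = closure-projSub V-subspace
    ground∪PV : ground ∪ᵛ PV ≡ Vec.replicate m true
    ground∪PV = ⊆-antisym {U = ground ∪ᵛ PV} (λ i _ → T-lookup-replicate i)
      (λ i _ → subst T (sym (Vec.lookup-zipWith _∨_ i ground PV)) (case-PV i))
      where
      case-PV : ∀ i → T (lookup ground i ∨ lookup PV i)
      case-PV i with lookup PV i in i∈PV
      ... | true = T-∨⁺ʳ {lookup ground i} _
      ... | false = T-∨⁺ˡ (ground⁺ (subst T i∈PV))
    closure-ground : closure (ground ∪ᵛ PV) ≡ preimage quotient.fullSub
    closure-ground = trans (cong closure ground∪PV) (trans closure-all (sym preimage-fullSub))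

  fibre-term : ∀ U k → mono (qCorank U) (signedFibre U) k ≡
               sumℤ (λ A → mono (matroidCorank A) (sign (card A)) k) (fibre _≟_ flat groundSubsets U)
  fibre-term U k = trans (mono-sumℤ (qCorank U) (sign ∘ card) (fibre _≟_ flat groundSubsets U) k)
    (sumℤ-cong _ λ {A} A∈ → cong (λ e → mono e (sign (card A)) k)
      (sym (trans (matroidCorank≡qCorank-flat A)
                  (cong qCorank (proj₂ (fibre-∈⁻ _≟_ flat groundSubsets A∈))))))

proposition5p10 : (F : FiniteField) (E : FinVectorSpace F) (ρ : QSub E → ℕ) →
    QMat.IsQMatroid E ρ → (V : QSub E) → T (isSubspaceE E V) → (k : ℕ) →
    QMat.contractCharPoly E ρ V k ≡
      matCharPoly (contract (projectivization E ρ) (QMat.projSub E V)) k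
proposition5p10 F E ρ _ V V-sub k = begin
  QMat.contractCharPoly E ρ V k
    ≡⟨ sumP-map (λ U → mono (qCorank U) (quotient.μ quotient.zeroSub U)) quotient.subspaces k ⟩
  sumℤ (λ U → mono (qCorank U) (quotient.μ quotient.zeroSub U) k) quotient.subspaces
    ≡⟨ sumℤ-cong quotient.subspaces (λ {U} U∈ → cong (λ c → mono (qCorank U) c k) (μ≡signedFibre U U∈)) ⟩
  sumℤ (λ U → mono (qCorank U) (signedFibre U) k) quotient.subspaces
    ≡⟨ sumℤ-cong quotient.subspaces (λ {U} _ → fibre-term U k) ⟩
  sumℤ (λ U → sumℤ term (fibre _≟_ flat groundSubsets U)) quotient.subspaces
    ≡⟨ sumℤ-fibres _≟_ term flat groundSubsets quotient.subspaces-unique (λ {A} _ → flat-∈ A) ⟨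
  sumℤ term groundSubsets
    ≡⟨ sumP-map (λ A → mono (matroidCorank A) (sign (card A))) groundSubsets k ⟨
  matCharPoly M/PV k ∎
  where
  open Contraction E ρ V V-sub
  open Quotient E V V-sub using (module quotient)
  open ≡-Reasoning
  term : Vec Bool (QMat.m E) → ℤ
  term A = mono (matroidCorank A) (sign (card A)) k
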